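{- Let $\widetilde H=\{x\in\mathbb{F}_2^8 : x_8=0\}$ and let $\iota\colon\mathbb{F}_2^7\to\widetilde H$ be the canonical embedding (applied elementwise to subspaces and sets of subspaces). Let $F$ be a set of $4$-dimensional subspaces of $\mathbb{F}_2^7$ with $\#F\in\{16,17\}$. Let $\mathrm{Var}_7(F)$ be the set of $3$-dimensional subspaces $U$ of $\mathbb{F}_2^7$ with $\dim(U\cap S)\le1$ for all $S\in F$, and for a subspace $W$ let $\omega(F,W)$ be the maximum size of a subset $\Omega\subseteq\mathcal{I}_{\mathrm{Var}_7(F)}(W)$ with $\dim(U_1\cap U_2)\le1$ for all distinct $U_1,U_2\in\Omega$. Define $z_7^{\mathrm{BLP}}(F)$ as the maximum of $\sum_{U\in\mathrm{Var}_7(F)}x_U+\#F$ subject to: (i) $\sum_{U\in\mathcal{I}_{\mathrm{Var}_7(F)}(W)}x_U\le \#F-\#\mathcal{I}_F(W)$ for every $1$-dimensional $W\le\mathbb{F}_2^7$; (ii) $\sum_{U\in\mathcal{I}_{\mathrm{Var}_7(F)}(W)}x_U\le 1$ for every $2$-dimensional $W\le\mathbb{F}_2^7$ not contained in any $S\in F$; (iii) $\sum_{U\in\mathcal{I}_{\mathrm{Var}_7(F)}(W)}x_U\le 1$ for every $4$-dimensional $W\le\mathbb{F}_2^7$ with $W\notin F$; (iv) $\sum_{U\in\mathcal{I}_{\mathrm{Var}_7(F)}(W)}x_U\le \min\{\omega(F,W),7\}$ for every $5$-dimensional $W\le\mathbb{F}_2^7$ containing no $S\in F$; (v) $\sum_{U\in\mathcal{I}_{\mathrm{Var}_7(F)}(W)}x_U\le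 2(\#F-\#\mathcal{I}_F(W))$ for every $6$-dimensional $W\le\mathbb{F}_2^7$; (vi) $\sum_{U\in\mathrm{Var}_7(F)}x_U+\#F\ge 255$; (vii) $x_U\in\{0,1\}$ for all $U\in\mathrm{Var}_7(F)$. Then every set $\mathcal{C}$ of $4$-dimensional subspaces of $\mathbb{F}_2^8$ with pairwise subspace distance at least $6$, with $\#\mathcal{C}\ge255$, $\iota(F)\subseteq\mathcal{C}$, and such that each point and each hyperplane of $\mathbb{F}_2^8$ is incident with at most $\#F$ elements of $\mathcal{C}$, satisfies $\#\mathcal{C}\le z_7^{\mathrm{BLP}}(F)$.
   Context: The subspace distance is $\mathrm{d}_{\mathrm{s}}(U,W)=\dim(U+W)-\dim(U\cap W)$. For a set $\mathcal{S}$ of subspaces and a subspace $X$, $\mathcal{I}_{\mathcal{S}}(X)=\{U\in\mathcal{S}: U\le X\text{ or }X\le U\}$; a subspace $U$ is incident with $X$ if $U\le X$ or $X\le U$. Points are $1$-dimensional and hyperplanes $7$-dimensional subspaces of $\mathbb{F}_2^8$. -}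

module Defs where

open import Data.Bool using (Bool; true; false; _∧_; _∨_; not; if_then_else_; _xor_)
open import Data.Nat using (ℕ; zero; suc; _+_; _*_; _∸_; _≤_)
open import Data.Vec using (Vec; []; _∷_; replicate; zipWith; last; init)
open import Data.List using (List; []; _∷_; _++_; map; length; filterᵇ)
open import Data.Bool.ListAction using (any; all)
open import Data.List.Relation.Unary.All using (All)
open import Data.List.Relation.Unary.Any using (Any)
open import Data.List.Relation.Unary.AllPairs using (AllPairs)
open import Data.List.Membership.Propositional using (_∈_)
open import Data.Product using (Σ; ∃; _×_; _,_)
open import Relation.Binary.PropositionalEquality using (_≡_)
open import Relation.Nullary using (¬_)

F2^ : ℕ → Set
F2^ n = Vec Bool n

zeroV : ∀ {n} → F2^ n
zeroV = replicate _ false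

_⊕_ : ∀ {n} → F2^ n → F2^ n → F2^ n
_⊕_ = zipWith _xor_

allVecs : (n : ℕ) → List (F2^ n)
allVecs zero = [] ∷ []
allVecs (suc n) = map (false ∷_) (allVecs n) ++ map (true ∷_) (allVecs n)

-- Subsets of F₂ⁿ given by a (decidable) membership function.
-- A subspace is such a subset that has a dimension (see HasDim).

Sub : ℕ → Set
Sub n = F2^ n → Bool

_≐_ : ∀ {n} → Sub n → Sub n → Set
U ≐ W = ∀ v → U v ≡ W v

_⊑_ : ∀ {n} → Sub n → Sub n → Set
U ⊑ W = ∀ v → U v ≡ true → W v ≡ true

_⊑ᵇ_ : ∀ {n} → Sub n → Sub n → Bool
_⊑ᵇ_ {n} U W = all (λ v → not (U v) ∨ W v) (allVecs n)

incidentᵇ : ∀ {n} → Sub n → Sub n → Bool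
incidentᵇ U W = (U ⊑ᵇ W) ∨ (W ⊑ᵇ U)

_∩_ : ∀ {n} → Sub n → Sub n → Sub n
(U ∩ W) v = U v ∧ W v

_+ˢ_ : ∀ {n} → Sub n → Sub n → Sub n
_+ˢ_ {n} U W v = any (λ u → U u ∧ W (v ⊕ u)) (allVecs n)

comb : ∀ {n k} → Vec (F2^ n) k → Vec Bool k → F2^ n
comb [] [] = zeroV
comb (b ∷ bs) (c ∷ cs) = if c then b ⊕ comb bs cs else comb bs cs

LinIndep : ∀ {n k} → Vec (F2^ n) k → Set
LinIndep {k = k} b = ∀ c → comb b c ≡ zeroV → c ≡ replicate k false

Spans : ∀ {n k} → Vec (F2^ n) k → Sub n → Set
Spans b U = ∀ v → (U v ≡ true → ∃ λ c → comb b c ≡ v) × ((∃ λ c → comb b c ≡ v) → U v ≡ true)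

HasDim : ∀ {n} → Sub n → ℕ → Set
HasDim {n} U k = Σ (Vec (F2^ n) k) λ b → LinIndep b × Spans b U

DimAtMost : ∀ {n} → Sub n → ℕ → Set
DimAtMost U m = ∃ λ k → k ≤ m × HasDim U k

SubspaceDist : ∀ {n} → Sub n → Sub n → ℕ → Set
SubspaceDist U W d = ∃ λ a → ∃ λ b → HasDim (U +ˢ W) a × HasDim (U ∩ W) b × d + b ≡ a

-- Finite sets of subspaces: duplicate-free lists

Distinct : ∀ {n} → List (Sub n) → Set
Distinct = AllPairs (λ U W → ¬ (U ≐ W))

countInc : ∀ {n} → Sub n → List (Sub n) → ℕ
countInc W S = length (filterᵇ (λ U → incidentᵇ U W) S)

_∈ˢ_ : ∀ {n} → Sub n → List (Sub n) → Set
U ∈ˢ S = Any (λ V → U ≐ V) S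

ι : Sub 7 → Sub 8
ι U v = not (last v) ∧ U (init v)

InVar : List (Sub 7) → Sub 7 → Set
InVar F U = HasDim U 3 × All (λ S → DimAtMost (U ∩ S) 1) F

-- "k ≤ ω(F,W)": some Ω ⊆ I_{Var₇(F)}(W), pairwise dim(U₁ ∩ U₂) ≤ 1,
-- with #Ω ≥ k
≤ω : List (Sub 7) → Sub 7 → ℕ → Set
≤ω F W k = Σ (List (Sub 7)) λ Ω →
  Distinct Ω ×
  All (λ U → InVar F U × incidentᵇ U W ≡ true) Ω ×
  AllPairs (λ U₁ U₂ → DimAtMost (U₁ ∩ U₂) 1) Ω ×
  k ≤ length Ω

-- A feasible 0/1 solution of the BLP, encoded by X = {U : x_U = 1}
-- (a duplicate-free list of elements of Var₇(F)); then
-- Σ_{U ∈ I_{Var₇(F)}(W)} x_U = countInc W X and Σ x_U = length X.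
BLPFeasible : List (Sub 7) → List (Sub 7) → Set
BLPFeasible F X =
  Distinct X ×
  All (InVar F) X ×
  (∀ W → HasDim W 1 → countInc W X ≤ length F ∸ countInc W F) ×
  (∀ W → HasDim W 2 → All (λ S → ¬ (W ⊑ S)) F → countInc W X ≤ 1) ×
  (∀ W → HasDim W 4 → ¬ (W ∈ˢ F) → countInc W X ≤ 1) ×
  (∀ W → HasDim W 5 → All (λ S → ¬ (S ⊑ W)) F →
     countInc W X ≤ 7 × ≤ω F W (countInc W X)) ×
  (∀ W → HasDim W 6 → countInc W X ≤ 2 * (length F ∸ countInc W F)) ×
  255 ≤ length X + length F

-- "k ≤ z₇^BLP(F)": some feasible solution has objective value ≥ k
≤zBLP : List (Sub 7) → ℕ → Set
≤zBLP F k = Σ (List (Sub 7)) λ X → BLPFeasible F X × k ≤ length X + length F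

-- Let Ĥ = {x : x₈ = 0}. By the hyperplane condition at most #F codewords lie in Ĥ; every other
-- codeword V is a transversal 4-space meeting Ĥ in a 3-space, and the traces of these, read in F₂⁷,
-- form the 0/1 solution X, so #C ≤ #X + #F. Two 4-spaces of F₂⁸ at distance ≥ 6 share at most a
-- point, and each constraint follows from this: (ii)–(iv) are packing bounds in F₂⁸, while (i) and
-- (v) count the codewords through the point ι W, resp. inside the hyperplanes ι W + ⟨(a, 1)⟩, where
-- the copies ι S of the S ∈ F incident with W also lie. Dimensions are handled through
-- cardinalities: a k-space has 2ᵏ elements, and |U + W| · |U ∩ W| = |U| · |W|.
module Submission where

open import Defs
open import Data.Bool using (Bool; true; false; _∧_; _∨_; not; _xor_)
open import Data.Bool.Properties using (xor-comm; xor-assoc; xor-same; xor-identityˡ; xor-identityʳ; ∧-comm; T-≡)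
open import Data.Nat using (ℕ; zero; suc; _+_; _*_; _∸_; _≤_; _<_; _^_; z≤n; s≤s; _≤?_)
open import Data.Nat.Properties
open import Algebra.Properties.CommutativeSemigroup +-commutativeSemigroup using () renaming (interchange to +-interchange)
open import Data.Vec using (Vec; []; _∷_; replicate; zipWith; last; init; _∷ʳ_; initLast)
import Data.Vec as Vec
open import Data.Vec.Properties
  using (zipWith-comm; zipWith-assoc; zipWith-identityˡ; zipWith-identityʳ; init-∷ʳ; last-∷ʳ; ∷-injectiveˡ; ∷-injectiveʳ)
open import Data.List using (List; []; _∷_; _++_; map; length; filterᵇ)
open import Data.List.Properties using (length-map; length-removeAt′)
open import Data.Bool.ListAction using (any; all)
open import Data.List.Relation.Unary.All using (All; []; _∷_)
import Data.List.Relation.Unary.All as All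
import Data.List.Relation.Unary.All.Properties as All
open import Data.List.Relation.Unary.Any using (Any; here; there; _─_; index)
open import Data.List.Relation.Unary.AllPairs using (AllPairs; []; _∷_)
import Data.List.Relation.Unary.AllPairs.Properties as AllPairs
open import Data.Product using (Σ; ∃; _×_; _,_; proj₁; proj₂)
open import Data.Sum using (_⊎_; inj₁; inj₂; [_,_]′)
open import Data.Empty using (⊥; ⊥-elim)
open import Relation.Binary.PropositionalEquality
open import Relation.Nullary using (¬_; yes; no)
open import Relation.Nullary.Decidable using (T?)
open import Function using (_∘_)
open import Function.Bundles using (Equivalence)

∨-true : ∀ {a b} → a ∨ b ≡ true → a ≡ true ⊎ b ≡ true
∨-true {true} h = inj₁ refl
∨-true {false} h = inj₂ h

∨-trueˡ : ∀ {a} b → a ≡ true → a ∨ b ≡ true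
∨-trueˡ b refl = refl

∨-trueʳ : ∀ a {b} → b ≡ true → a ∨ b ≡ true
∨-trueʳ false h = h
∨-trueʳ true h = refl

∧-true : ∀ {a b} → a ∧ b ≡ true → a ≡ true × b ≡ true
∧-true {true} {true} h = refl , refl

∧-true⁺ : ∀ {a b} → a ≡ true → b ≡ true → a ∧ b ≡ true
∧-true⁺ refl refl = refl

not-true : ∀ {a} → not a ≡ true → a ≡ false
not-true {false} h = refl

not-false : ∀ {a} → not a ≡ false → a ≡ true
not-false {true} h = refl

true≢false : true ≡ false → ⊥
true≢false ()

⊕-comm : ∀ {n} (x y : F2^ n) → x ⊕ y ≡ y ⊕ x
⊕-comm = zipWith-comm xor-comm

⊕-assoc : ∀ {n} (x y z : F2^ n) → (x ⊕ y) ⊕ z ≡ x ⊕ (y ⊕ z)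
⊕-assoc = zipWith-assoc xor-assoc

⊕-identityˡ : ∀ {n} (x : F2^ n) → zeroV ⊕ x ≡ x
⊕-identityˡ = zipWith-identityˡ xor-identityˡ

⊕-identityʳ : ∀ {n} (x : F2^ n) → x ⊕ zeroV ≡ x
⊕-identityʳ = zipWith-identityʳ xor-identityʳ

⊕-self : ∀ {n} (x : F2^ n) → x ⊕ x ≡ zeroV
⊕-self [] = refl
⊕-self (a ∷ x) = cong₂ _∷_ (xor-same a) (⊕-self x)

⊕-cancelʳ : ∀ {n} (x a : F2^ n) → (x ⊕ a) ⊕ a ≡ x
⊕-cancelʳ x a = begin
  (x ⊕ a) ⊕ a  ≡⟨ ⊕-assoc x a a ⟩
  x ⊕ (a ⊕ a)  ≡⟨ cong (x ⊕_) (⊕-self a) ⟩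
  x ⊕ zeroV    ≡⟨ ⊕-identityʳ x ⟩
  x            ∎
  where open ≡-Reasoning

⊕-cancelˡ : ∀ {n} (a x : F2^ n) → a ⊕ (a ⊕ x) ≡ x
⊕-cancelˡ a x = begin
  a ⊕ (a ⊕ x)  ≡⟨ sym (⊕-assoc a a x) ⟩
  (a ⊕ a) ⊕ x  ≡⟨ cong (_⊕ x) (⊕-self a) ⟩
  zeroV ⊕ x    ≡⟨ ⊕-identityˡ x ⟩
  x            ∎
  where open ≡-Reasoning

⊕-interchange : ∀ {n} (x y u w : F2^ n) → (x ⊕ y) ⊕ (u ⊕ w) ≡ (x ⊕ u) ⊕ (y ⊕ w)
⊕-interchange x y u w = begin
  (x ⊕ y) ⊕ (u ⊕ w)  ≡⟨ ⊕-assoc x y (u ⊕ w) ⟩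
  x ⊕ (y ⊕ (u ⊕ w))  ≡⟨ cong (x ⊕_) (sym (⊕-assoc y u w)) ⟩
  x ⊕ ((y ⊕ u) ⊕ w)  ≡⟨ cong (λ t → x ⊕ (t ⊕ w)) (⊕-comm y u) ⟩
  x ⊕ ((u ⊕ y) ⊕ w)  ≡⟨ cong (x ⊕_) (⊕-assoc u y w) ⟩
  x ⊕ (u ⊕ (y ⊕ w))  ≡⟨ sym (⊕-assoc x u (y ⊕ w)) ⟩
  (x ⊕ u) ⊕ (y ⊕ w)  ∎
  where open ≡-Reasoning

∷ʳ-⊕ : ∀ {n} (u w : F2^ n) a b → (u ∷ʳ a) ⊕ (w ∷ʳ b) ≡ (u ⊕ w) ∷ʳ (a xor b)
∷ʳ-⊕ [] [] a b = refl
∷ʳ-⊕ (x ∷ u) (y ∷ w) a b = cong ((x xor y) ∷_) (∷ʳ-⊕ u w a b)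

zeroV-∷ʳ : ∀ n → zeroV {suc n} ≡ zeroV {n} ∷ʳ false
zeroV-∷ʳ zero = refl
zeroV-∷ʳ (suc n) = cong (false ∷_) (zeroV-∷ʳ n)

init-∷ʳ-last : ∀ {n} (v : F2^ (suc n)) → v ≡ init v ∷ʳ last v
init-∷ʳ-last v = proj₂ (proj₂ (initLast v))

∷ʳ-elim : ∀ {n} (P : F2^ (suc n) → Set) → (∀ u b → P (u ∷ʳ b)) → ∀ v → P v
∷ʳ-elim P h v = subst P (sym (init-∷ʳ-last v)) (h (init v) (last v))

last-⊕ : ∀ {n} (x y : F2^ (suc n)) → last (x ⊕ y) ≡ last x xor last y
last-⊕ = ∷ʳ-elim _ λ u a → ∷ʳ-elim _ λ w b → begin
  last ((u ∷ʳ a) ⊕ (w ∷ʳ b))      ≡⟨ cong last (∷ʳ-⊕ u w a b) ⟩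
  last ((u ⊕ w) ∷ʳ (a xor b))     ≡⟨ last-∷ʳ (a xor b) (u ⊕ w) ⟩
  a xor b                         ≡⟨ sym (cong₂ _xor_ (last-∷ʳ a u) (last-∷ʳ b w)) ⟩
  last (u ∷ʳ a) xor last (w ∷ʳ b) ∎
  where open ≡-Reasoning

last-zeroV : ∀ n → last (zeroV {suc n}) ≡ false
last-zeroV n = trans (cong last (zeroV-∷ʳ n)) (last-∷ʳ false (zeroV {n}))

-- Sums over F₂ⁿ

χ : Bool → ℕ
χ true = 1
χ false = 0

opaque
  ∑ : (n : ℕ) → (F2^ n → ℕ) → ℕ
  ∑ zero f = f []
  ∑ (suc n) f = ∑ n (λ v → f (false ∷ v)) + ∑ n (λ v → f (true ∷ v))

  ∑-zero : ∀ (f : F2^ 0 → ℕ) → ∑ 0 f ≡ f []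
  ∑-zero f = refl

  ∑-suc : ∀ n (f : F2^ (suc n) → ℕ) → ∑ (suc n) f ≡ ∑ n (λ v → f (false ∷ v)) + ∑ n (λ v → f (true ∷ v))
  ∑-suc n f = refl

  ∑-cong : ∀ n {f g : F2^ n → ℕ} → (∀ v → f v ≡ g v) → ∑ n f ≡ ∑ n g
  ∑-cong zero e = e []
  ∑-cong (suc n) e = cong₂ _+_ (∑-cong n (λ v → e (false ∷ v))) (∑-cong n (λ v → e (true ∷ v)))

  ∑-mono-≤ : ∀ n {f g : F2^ n → ℕ} → (∀ v → f v ≤ g v) → ∑ n f ≤ ∑ n g
  ∑-mono-≤ zero e = e []
  ∑-mono-≤ (suc n) e = +-mono-≤ (∑-mono-≤ n (λ v → e (false ∷ v))) (∑-mono-≤ n (λ v → e (true ∷ v)))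

  ∑-+ : ∀ n (f g : F2^ n → ℕ) → ∑ n (λ v → f v + g v) ≡ ∑ n f + ∑ n g
  ∑-+ zero f g = refl
  ∑-+ (suc n) f g = trans (cong₂ _+_ (∑-+ n _ _) (∑-+ n _ _)) (+-interchange (∑ n (λ v → f (false ∷ v))) _ _ _)

  ∑-*ʳ : ∀ n (f : F2^ n → ℕ) c → ∑ n (λ v → f v * c) ≡ ∑ n f * c
  ∑-*ʳ zero f c = refl
  ∑-*ʳ (suc n) f c = trans (cong₂ _+_ (∑-*ʳ n _ c) (∑-*ʳ n _ c)) (sym (*-distribʳ-+ c (∑ n (λ v → f (false ∷ v))) _))

  ∑-const : ∀ n c → ∑ n (λ _ → c) ≡ 2 ^ n * c
  ∑-const zero c = sym (+-identityʳ c)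
  ∑-const (suc n) c = begin
    ∑ n (λ _ → c) + ∑ n (λ _ → c)  ≡⟨ cong₂ _+_ (∑-const n c) (∑-const n c) ⟩
    2 ^ n * c + 2 ^ n * c          ≡⟨ sym (*-distribʳ-+ c (2 ^ n) (2 ^ n)) ⟩
    (2 ^ n + 2 ^ n) * c            ≡⟨ cong (λ t → (2 ^ n + t) * c) (sym (+-identityʳ (2 ^ n))) ⟩
    2 ^ suc n * c                  ∎
    where open ≡-Reasoning

  ∑-translate : ∀ n (f : F2^ n → ℕ) (w : F2^ n) → ∑ n (λ v → f (v ⊕ w)) ≡ ∑ n f
  ∑-translate zero f [] = refl
  ∑-translate (suc n) f (false ∷ w) =
    cong₂ _+_ (∑-translate n (λ v → f (false ∷ v)) w) (∑-translate n (λ v → f (true ∷ v)) w)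
  ∑-translate (suc n) f (true ∷ w) =
    trans (cong₂ _+_ (∑-translate n (λ v → f (true ∷ v)) w) (∑-translate n (λ v → f (false ∷ v)) w))
          (+-comm (∑ n (λ v → f (true ∷ v))) _)

  ∑-comm : ∀ n m (f : F2^ n → F2^ m → ℕ) → ∑ n (λ x → ∑ m (λ y → f x y)) ≡ ∑ m (λ y → ∑ n (λ x → f x y))
  ∑-comm zero m f = refl
  ∑-comm (suc n) m f = trans (cong₂ _+_ (∑-comm n m _) (∑-comm n m _)) (sym (∑-+ m _ _))

  ∑-∷ʳ : ∀ n (f : F2^ (suc n) → ℕ) → ∑ (suc n) f ≡ ∑ n (λ u → f (u ∷ʳ false)) + ∑ n (λ u → f (u ∷ʳ true))
  ∑-∷ʳ zero f = refl
  ∑-∷ʳ (suc n) f =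
    trans (cong₂ _+_ (∑-∷ʳ n (λ v → f (false ∷ v))) (∑-∷ʳ n (λ v → f (true ∷ v))))
          (+-interchange (∑ n (λ u → f (false ∷ (u ∷ʳ false)))) _ _ _)

  term≤∑ : ∀ n (f : F2^ n → ℕ) v → f v ≤ ∑ n f
  term≤∑ zero f [] = ≤-refl
  term≤∑ (suc n) f (false ∷ v) = ≤-trans (term≤∑ n (λ u → f (false ∷ u)) v) (m≤m+n _ _)
  term≤∑ (suc n) f (true ∷ v) = ≤-trans (term≤∑ n (λ u → f (true ∷ u)) v) (m≤n+m _ _)

∑-*ˡ : ∀ n (f : F2^ n → ℕ) c → ∑ n (λ v → c * f v) ≡ c * ∑ n f
∑-*ˡ n f c = trans (∑-cong n (λ v → *-comm c (f v))) (trans (∑-*ʳ n f c) (*-comm _ c))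

card : (n : ℕ) → Sub n → ℕ
card n P = ∑ n (λ v → χ (P v))

card-cong : ∀ n {P Q : Sub n} → (∀ v → P v ≡ Q v) → card n P ≡ card n Q
card-cong n e = ∑-cong n (λ v → cong χ (e v))

χ-mono : ∀ {a b} → (a ≡ true → b ≡ true) → χ a ≤ χ b
χ-mono {false} h = z≤n
χ-mono {true} h rewrite h refl = ≤-refl

card-mono : ∀ n {P Q : Sub n} → P ⊑ Q → card n P ≤ card n Q
card-mono n h = ∑-mono-≤ n (λ v → χ-mono (h v))

χ-∨+χ-∧ : ∀ a b → χ (a ∨ b) + χ (a ∧ b) ≡ χ a + χ b
χ-∨+χ-∧ false false = refl
χ-∨+χ-∧ false true = refl
χ-∨+χ-∧ true false = refl
χ-∨+χ-∧ true true = refl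

card-∨+card-∧ : ∀ n (P Q : Sub n) → card n (λ v → P v ∨ Q v) + card n (λ v → P v ∧ Q v) ≡ card n P + card n Q
card-∨+card-∧ n P Q = trans (sym (∑-+ n _ _)) (trans (∑-cong n (λ v → χ-∨+χ-∧ (P v) (Q v))) (∑-+ n _ _))

card-empty : ∀ n (P : Sub n) → (∀ v → P v ≡ false) → card n P ≡ 0
card-empty n P h = trans (∑-cong n (λ v → cong χ (h v))) (trans (∑-const n 0) (*-zeroʳ (2 ^ n)))

card-full : ∀ n (P : Sub n) → (∀ v → P v ≡ true) → card n P ≡ 2 ^ n
card-full n P h = trans (∑-cong n (λ v → cong χ (h v))) (trans (∑-const n 1) (*-identityʳ (2 ^ n)))

card+card-not : ∀ n (P : Sub n) → card n P + card n (λ v → not (P v)) ≡ 2 ^ n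
card+card-not n P = trans (sym (∑-+ n _ _)) (trans (∑-cong n (λ v → χ-not (P v))) (trans (∑-const n 1) (*-identityʳ _)))
  where
  χ-not : ∀ a → χ a + χ (not a) ≡ 1
  χ-not false = refl
  χ-not true = refl

card≤2^n : ∀ n (P : Sub n) → card n P ≤ 2 ^ n
card≤2^n n P = subst (card n P ≤_) (card+card-not n P) (m≤m+n _ _)

card-nonempty : ∀ n (P : Sub n) v → P v ≡ true → 1 ≤ card n P
card-nonempty n P v h = subst (λ b → χ b ≤ card n P) h (term≤∑ n (λ u → χ (P u)) v)

card≡2^n⇒full : ∀ n (P : Sub n) → card n P ≡ 2 ^ n → ∀ v → P v ≡ true
card≡2^n⇒full n P h v with P v in eq
... | true = refl
... | false = ⊥-elim (<-irrefl refl (≤-trans (s≤s (≤-reflexive (sym h))) complement))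
  where
  complement : 1 + card n P ≤ 2 ^ n
  complement = begin
    1 + card n P                             ≡⟨ +-comm 1 (card n P) ⟩
    card n P + 1                             ≤⟨ +-monoʳ-≤ (card n P) (card-nonempty n _ v (cong not eq)) ⟩
    card n P + card n (λ u → not (P u))      ≡⟨ card+card-not n P ⟩
    2 ^ n                                    ∎
    where open ≤-Reasoning

card-translate : ∀ n (P : Sub n) w → card n (λ v → P (v ⊕ w)) ≡ card n P
card-translate n P w = ∑-translate n (λ v → χ (P v)) w

card-∷ʳ : ∀ n (P : Sub (suc n)) → card (suc n) P ≡ card n (λ u → P (u ∷ʳ false)) + card n (λ u → P (u ∷ʳ true))
card-∷ʳ n P = ∑-∷ʳ n (λ v → χ (P v))

-- Subspaces, dimension and cardinality

IsSubspace : ∀ {n} → Sub n → Set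
IsSubspace U = U zeroV ≡ true × (∀ x y → U x ≡ true → U y ≡ true → U (x ⊕ y) ≡ true)

translate-invariant : ∀ {n} {U : Sub n} → IsSubspace U → ∀ {a} → U a ≡ true → ∀ v → U (v ⊕ a) ≡ U v
translate-invariant {U = U} (_ , closed) {a} ha v with U v in e1 | U (v ⊕ a) in e2
... | true | true = refl
... | false | false = refl
... | true | false = ⊥-elim (true≢false (trans (sym (closed v a e1 ha)) e2))
... | false | true = ⊥-elim (true≢false (trans (sym (subst (λ t → U t ≡ true) (⊕-cancelʳ v a) (closed (v ⊕ a) a e2 ha))) e1))

∩-isSubspace : ∀ {n} {U W : Sub n} → IsSubspace U → IsSubspace W → IsSubspace (U ∩ W)
∩-isSubspace (zU , cU) (zW , cW) = ∧-true⁺ zU zW ,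
  λ x y hx hy → ∧-true⁺ (cU x y (proj₁ (∧-true hx)) (proj₁ (∧-true hy))) (cW x y (proj₂ (∧-true hx)) (proj₂ (∧-true hy)))

comb-⊕ : ∀ {n k} (b : Vec (F2^ n) k) c c' → comb b c ⊕ comb b c' ≡ comb b (zipWith _xor_ c c')
comb-⊕ [] [] [] = ⊕-self zeroV
comb-⊕ (b ∷ bs) (false ∷ c) (false ∷ c') = comb-⊕ bs c c'
comb-⊕ (b ∷ bs) (true ∷ c) (false ∷ c') = trans (⊕-assoc b _ _) (cong (b ⊕_) (comb-⊕ bs c c'))
comb-⊕ (b ∷ bs) (false ∷ c) (true ∷ c') =
  trans (sym (⊕-assoc (comb bs c) b _)) (trans (cong (_⊕ comb bs c') (⊕-comm (comb bs c) b))
  (trans (⊕-assoc b _ _) (cong (b ⊕_) (comb-⊕ bs c c'))))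
comb-⊕ (b ∷ bs) (true ∷ c) (true ∷ c') =
  trans (⊕-interchange b (comb bs c) b (comb bs c')) (trans (cong (_⊕ (comb bs c ⊕ comb bs c')) (⊕-self b))
  (trans (⊕-identityˡ _) (comb-⊕ bs c c')))

comb-zero : ∀ {n k} (b : Vec (F2^ n) k) → comb b (replicate k false) ≡ zeroV
comb-zero [] = refl
comb-zero (b ∷ bs) = comb-zero bs

hasDim⇒isSubspace : ∀ {n k} {U : Sub n} → HasDim U k → IsSubspace U
hasDim⇒isSubspace {k = k} (b , _ , spans) =
  proj₂ (spans zeroV) (replicate k false , comb-zero b) ,
  λ x y hx hy → let (c , ex) = proj₁ (spans x) hx ; (c' , ey) = proj₁ (spans y) hy in
    proj₂ (spans (x ⊕ y)) (zipWith _xor_ c c' , trans (sym (comb-⊕ b c c')) (cong₂ _⊕_ ex ey))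

isZero : ∀ {n} → F2^ n → Bool
isZero [] = true
isZero (a ∷ v) = not a ∧ isZero v

isZero-sound : ∀ {n} (v : F2^ n) → isZero v ≡ true → v ≡ zeroV
isZero-sound [] h = refl
isZero-sound (false ∷ v) h = cong (false ∷_) (isZero-sound v h)

isZero-zeroV : ∀ n → isZero (zeroV {n}) ≡ true
isZero-zeroV zero = refl
isZero-zeroV (suc n) = isZero-zeroV n

card-isZero : ∀ n → card n isZero ≡ 1
card-isZero zero = ∑-zero _
card-isZero (suc n) = trans (∑-suc n _) (cong₂ _+_ (card-isZero n) (card-empty n (λ _ → false) (λ _ → refl)))

spanᵇ : ∀ {n k} → Vec (F2^ n) k → Sub n
spanᵇ [] v = isZero v
spanᵇ (b ∷ bs) v = spanᵇ bs v ∨ spanᵇ bs (v ⊕ b)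

spanᵇ-sound : ∀ {n k} (bs : Vec (F2^ n) k) v → spanᵇ bs v ≡ true → ∃ λ c → comb bs c ≡ v
spanᵇ-sound [] v h = [] , sym (isZero-sound v h)
spanᵇ-sound (b ∷ bs) v h with ∨-true {spanᵇ bs v} h
... | inj₁ h₁ = let (c , e) = spanᵇ-sound bs v h₁ in false ∷ c , e
... | inj₂ h₂ = let (c , e) = spanᵇ-sound bs (v ⊕ b) h₂ in
  true ∷ c , trans (cong (b ⊕_) e) (trans (cong (b ⊕_) (⊕-comm v b)) (⊕-cancelˡ b v))

spanᵇ-complete : ∀ {n k} (bs : Vec (F2^ n) k) c → spanᵇ bs (comb bs c) ≡ true
spanᵇ-complete {n} [] [] = isZero-zeroV n
spanᵇ-complete (b ∷ bs) (false ∷ c) = ∨-trueˡ _ (spanᵇ-complete bs c)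
spanᵇ-complete (b ∷ bs) (true ∷ c) = ∨-trueʳ (spanᵇ bs (b ⊕ comb bs c))
  (subst (λ t → spanᵇ bs t ≡ true) (sym (trans (cong (_⊕ b) (⊕-comm b (comb bs c))) (⊕-cancelʳ (comb bs c) b)))
         (spanᵇ-complete bs c))

Spans⇒≡spanᵇ : ∀ {n k} {b : Vec (F2^ n) k} {U : Sub n} → Spans b U → ∀ v → U v ≡ spanᵇ b v
Spans⇒≡spanᵇ {b = b} {U} spans v with U v in e1 | spanᵇ b v in e2
... | true | true = refl
... | false | false = refl
... | true | false = let (c , e) = proj₁ (spans v) e1 in
  ⊥-elim (true≢false (trans (sym (subst (λ t → spanᵇ b t ≡ true) e (spanᵇ-complete b c))) e2))
... | false | true = ⊥-elim (true≢false (trans (sym (proj₂ (spans v) (spanᵇ-sound b v e2))) e1))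

LinIndep-tail : ∀ {n k} {b : F2^ n} {bs : Vec (F2^ n) k} → LinIndep (b ∷ bs) → LinIndep bs
LinIndep-tail ind c e = ∷-injectiveʳ (ind (false ∷ c) e)

-- The span of b ∷ bs is the disjoint union of span bs and its translate by b.
card-spanᵇ : ∀ {n k} (bs : Vec (F2^ n) k) → LinIndep bs → card n (spanᵇ bs) ≡ 2 ^ k
card-spanᵇ {n} [] _ = card-isZero n
card-spanᵇ {n} {suc k} (b ∷ bs) ind = +-cancelʳ-≡ _ _ _ (begin
  card n (spanᵇ (b ∷ bs)) + card n (λ v → S v ∧ S (v ⊕ b))  ≡⟨ card-∨+card-∧ n S (λ v → S (v ⊕ b)) ⟩
  card n S + card n (λ v → S (v ⊕ b))                         ≡⟨ cong₂ _+_ IH (trans (card-translate n S b) IH) ⟩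
  2 ^ k + 2 ^ k                                              ≡⟨ cong (2 ^ k +_) (sym (+-identityʳ (2 ^ k))) ⟩
  2 ^ suc k                                                  ≡⟨ sym (+-identityʳ _) ⟩
  2 ^ suc k + 0                                              ≡⟨ cong (2 ^ suc k +_) (sym disjoint) ⟩
  2 ^ suc k + card n (λ v → S v ∧ S (v ⊕ b))                 ∎)
  where
  open ≡-Reasoning
  S = spanᵇ bs
  IH = card-spanᵇ bs (LinIndep-tail ind)
  disjoint : card n (λ v → S v ∧ S (v ⊕ b)) ≡ 0
  disjoint = card-empty n _ f
    where
    f : ∀ v → S v ∧ S (v ⊕ b) ≡ false
    f v with S v in e1 | S (v ⊕ b) in e2
    ... | false | _ = refl
    ... | true | false = refl
    ... | true | true = ⊥-elim (true≢false (∷-injectiveˡ (ind (true ∷ zipWith _xor_ c c') b-in-span)))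
      where
      c = proj₁ (spanᵇ-sound bs v e1)
      c' = proj₁ (spanᵇ-sound bs (v ⊕ b) e2)
      b-in-span : b ⊕ comb bs (zipWith _xor_ c c') ≡ zeroV
      b-in-span = begin
        b ⊕ comb bs (zipWith _xor_ c c')  ≡⟨ cong (b ⊕_) (sym (comb-⊕ bs c c')) ⟩
        b ⊕ (comb bs c ⊕ comb bs c')       ≡⟨ cong (b ⊕_) (cong₂ _⊕_ (proj₂ (spanᵇ-sound bs v e1))
                                                                    (proj₂ (spanᵇ-sound bs (v ⊕ b) e2))) ⟩
        b ⊕ (v ⊕ (v ⊕ b))                  ≡⟨ cong (b ⊕_) (⊕-cancelˡ v b) ⟩
        b ⊕ b                              ≡⟨ ⊕-self b ⟩
        zeroV                              ∎

hasDim⇒card : ∀ {n k} {U : Sub n} → HasDim U k → card n U ≡ 2 ^ k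
hasDim⇒card {n} (b , ind , spans) = trans (card-cong n (Spans⇒≡spanᵇ {b = b} spans)) (card-spanᵇ b ind)

opaque
  search : ∀ n (P : F2^ n → Bool) → (Σ (F2^ n) λ v → P v ≡ true) ⊎ (∀ v → P v ≡ false)
  search zero P with P [] in e
  ... | true = inj₁ ([] , e)
  ... | false = inj₂ λ { [] → e }
  search (suc n) P with search n (λ v → P (false ∷ v)) | search n (λ v → P (true ∷ v))
  ... | inj₁ (v , e) | _ = inj₁ (false ∷ v , e)
  ... | inj₂ _ | inj₁ (v , e) = inj₁ (true ∷ v , e)
  ... | inj₂ h₁ | inj₂ h₂ = inj₂ λ { (false ∷ v) → h₁ v ; (true ∷ v) → h₂ v }

comb-map-false∷ : ∀ {n k} (B : Vec (F2^ n) k) cs → comb (Vec.map (false ∷_) B) cs ≡ false ∷ comb B cs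
comb-map-false∷ [] [] = refl
comb-map-false∷ (b ∷ B) (false ∷ cs) = comb-map-false∷ B cs
comb-map-false∷ (b ∷ B) (true ∷ cs) = cong ((false ∷ b) ⊕_) (comb-map-false∷ B cs)

-- A basis of U is a basis of {v : U (false ∷ v)}, lifted by false ∷_, extended by
-- one vector of U with first coordinate true if there is any.
opaque
  isSubspace⇒hasDim : ∀ n (U : Sub n) → IsSubspace U → Σ ℕ (HasDim U)
  isSubspace⇒hasDim zero U (z , _) = 0 , [] , (λ { [] _ → refl }) , λ { [] → (λ _ → [] , refl) , (λ _ → z) }
  isSubspace⇒hasDim (suc n) U (z , closed)
    with isSubspace⇒hasDim n (λ v → U (false ∷ v)) (z , λ x y → closed (false ∷ x) (false ∷ y))
       | search n (λ v → U (true ∷ v))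
  ... | k , B , ind , spans | inj₁ (v₁ , e₁) = suc k , (true ∷ v₁) ∷ B⁺ , ind' , spans'
    where
    B⁺ : Vec (F2^ (suc n)) k
    B⁺ = Vec.map (false ∷_) B
    first-coord : ∀ cs → comb ((true ∷ v₁) ∷ B⁺) (true ∷ cs) ≡ true ∷ (v₁ ⊕ comb B cs)
    first-coord cs = cong ((true ∷ v₁) ⊕_) (comb-map-false∷ B cs)
    ind' : LinIndep ((true ∷ v₁) ∷ B⁺)
    ind' (true ∷ cs) e = ⊥-elim (true≢false (∷-injectiveˡ (trans (sym (first-coord cs)) e)))
    ind' (false ∷ cs) e = cong (false ∷_) (ind cs (∷-injectiveʳ (trans (sym (comb-map-false∷ B cs)) e)))
    spans' : Spans ((true ∷ v₁) ∷ B⁺) U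
    spans' (false ∷ w) =
      (λ h → let (cs , e) = proj₁ (spans w) h in false ∷ cs , trans (comb-map-false∷ B cs) (cong (false ∷_) e)) ,
      λ { (true ∷ cs , e) → ⊥-elim (true≢false (∷-injectiveˡ (trans (sym (first-coord cs)) e)))
        ; (false ∷ cs , e) → proj₂ (spans w) (cs , ∷-injectiveʳ (trans (sym (comb-map-false∷ B cs)) e)) }
    spans' (true ∷ w) =
      (λ h → let (cs , e) = proj₁ (spans (w ⊕ v₁)) (closed (true ∷ w) (true ∷ v₁) h e₁) in
        true ∷ cs , trans (first-coord cs)
          (cong (true ∷_) (trans (cong (v₁ ⊕_) e) (trans (cong (v₁ ⊕_) (⊕-comm w v₁)) (⊕-cancelˡ v₁ w))))) ,
      λ { (false ∷ cs , e) → ⊥-elim (true≢false (sym (∷-injectiveˡ (trans (sym (comb-map-false∷ B cs)) e))))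
        ; (true ∷ cs , e) → subst (λ t → U t ≡ true) (trans (cong ((true ∷ v₁) ⊕_) (sym (comb-map-false∷ B cs))) e)
             (closed (true ∷ v₁) (false ∷ comb B cs) e₁ (proj₂ (spans (comb B cs)) (cs , refl))) }
  ... | k , B , ind , spans | inj₂ none = k , B⁺ , ind' , spans'
    where
    B⁺ : Vec (F2^ (suc n)) k
    B⁺ = Vec.map (false ∷_) B
    ind' : LinIndep B⁺
    ind' cs e = ind cs (∷-injectiveʳ (trans (sym (comb-map-false∷ B cs)) e))
    spans' : Spans B⁺ U
    spans' (false ∷ w) =
      (λ h → let (cs , e) = proj₁ (spans w) h in cs , trans (comb-map-false∷ B cs) (cong (false ∷_) e)) ,
      λ { (cs , e) → proj₂ (spans w) (cs , ∷-injectiveʳ (trans (sym (comb-map-false∷ B cs)) e)) }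
    spans' (true ∷ w) =
      (λ h → ⊥-elim (true≢false (trans (sym h) (none w)))) ,
      λ { (cs , e) → ⊥-elim (true≢false (sym (∷-injectiveˡ (trans (sym (comb-map-false∷ B cs)) e)))) }

2^-cancel-≤ : ∀ a b → 2 ^ a ≤ 2 ^ b → a ≤ b
2^-cancel-≤ a b h with a ≤? b
... | yes a≤b = a≤b
... | no a≰b = ⊥-elim (<⇒≱ (^-monoʳ-< 2 (s≤s (s≤s z≤n)) (≰⇒> a≰b)) h)

2^-injective : ∀ a b → 2 ^ a ≡ 2 ^ b → a ≡ b
2^-injective a b e = ≤-antisym (2^-cancel-≤ a b (≤-reflexive e)) (2^-cancel-≤ b a (≤-reflexive (sym e)))

card⇒hasDim : ∀ {n k} {U : Sub n} → IsSubspace U → card n U ≡ 2 ^ k → HasDim U k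
card⇒hasDim {n} {k} {U} sU e with isSubspace⇒hasDim n U sU
... | k' , d = subst (HasDim U) (2^-injective k' k (trans (sym (hasDim⇒card d)) e)) d

card≤2⇒dimAtMost1 : ∀ {n} {U : Sub n} → IsSubspace U → card n U ≤ 2 → DimAtMost U 1
card≤2⇒dimAtMost1 {n} {U} sU h with isSubspace⇒hasDim n U sU
... | k , d = k , 2^-cancel-≤ k 1 (subst (_≤ 2) (hasDim⇒card d) h) , d

any-++ : ∀ {A : Set} (p : A → Bool) xs ys → any p (xs ++ ys) ≡ any p xs ∨ any p ys
any-++ p [] ys = refl
any-++ p (x ∷ xs) ys rewrite any-++ p xs ys with p x
... | true = refl
... | false = refl

any-map : ∀ {A B : Set} (p : B → Bool) (f : A → B) xs → any p (map f xs) ≡ any (λ x → p (f x)) xs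
any-map p f [] = refl
any-map p f (x ∷ xs) = cong (p (f x) ∨_) (any-map p f xs)

all-++ : ∀ {A : Set} (p : A → Bool) xs ys → all p (xs ++ ys) ≡ all p xs ∧ all p ys
all-++ p [] ys = refl
all-++ p (x ∷ xs) ys rewrite all-++ p xs ys with p x
... | true = refl
... | false = refl

all-map : ∀ {A B : Set} (p : B → Bool) (f : A → B) xs → all p (map f xs) ≡ all (λ x → p (f x)) xs
all-map p f [] = refl
all-map p f (x ∷ xs) = cong (p (f x) ∧_) (all-map p f xs)

any-allVecs-suc : ∀ n (p : F2^ (suc n) → Bool) →
  any p (allVecs (suc n)) ≡ any (λ v → p (false ∷ v)) (allVecs n) ∨ any (λ v → p (true ∷ v)) (allVecs n)
any-allVecs-suc n p =
  trans (any-++ p (map (false ∷_) (allVecs n)) _) (cong₂ _∨_ (any-map p (false ∷_) (allVecs n)) (any-map p (true ∷_) (allVecs n)))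

all-allVecs-suc : ∀ n (p : F2^ (suc n) → Bool) →
  all p (allVecs (suc n)) ≡ all (λ v → p (false ∷ v)) (allVecs n) ∧ all (λ v → p (true ∷ v)) (allVecs n)
all-allVecs-suc n p =
  trans (all-++ p (map (false ∷_) (allVecs n)) _) (cong₂ _∧_ (all-map p (false ∷_) (allVecs n)) (all-map p (true ∷_) (allVecs n)))

any-allVecs⁻ : ∀ n (p : F2^ n → Bool) → any p (allVecs n) ≡ true → ∃ λ v → p v ≡ true
any-allVecs⁻ zero p h with p [] in e
... | true = [] , e
any-allVecs⁻ (suc n) p h with ∨-true (trans (sym (any-allVecs-suc n p)) h)
... | inj₁ h₁ = let (v , e) = any-allVecs⁻ n _ h₁ in false ∷ v , e
... | inj₂ h₂ = let (v , e) = any-allVecs⁻ n _ h₂ in true ∷ v , e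

any-allVecs⁺ : ∀ n (p : F2^ n → Bool) v → p v ≡ true → any p (allVecs n) ≡ true
any-allVecs⁺ zero p [] h rewrite h = refl
any-allVecs⁺ (suc n) p (false ∷ v) h = trans (any-allVecs-suc n p) (∨-trueˡ _ (any-allVecs⁺ n _ v h))
any-allVecs⁺ (suc n) p (true ∷ v) h = trans (any-allVecs-suc n p) (∨-trueʳ _ (any-allVecs⁺ n _ v h))

all-allVecs⁻ : ∀ n (p : F2^ n → Bool) → all p (allVecs n) ≡ true → ∀ v → p v ≡ true
all-allVecs⁻ zero p h [] with p [] in e
... | true = refl
... | false = h
all-allVecs⁻ (suc n) p h (false ∷ v) = all-allVecs⁻ n _ (proj₁ (∧-true (trans (sym (all-allVecs-suc n p)) h))) v
all-allVecs⁻ (suc n) p h (true ∷ v) = all-allVecs⁻ n _ (proj₂ (∧-true (trans (sym (all-allVecs-suc n p)) h))) v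

all-allVecs⁺ : ∀ n (p : F2^ n → Bool) → (∀ v → p v ≡ true) → all p (allVecs n) ≡ true
all-allVecs⁺ zero p h rewrite h [] = refl
all-allVecs⁺ (suc n) p h =
  trans (all-allVecs-suc n p) (∧-true⁺ (all-allVecs⁺ n _ (λ v → h (false ∷ v))) (all-allVecs⁺ n _ (λ v → h (true ∷ v))))

⊑ᵇ⇒⊑ : ∀ {n} (U W : Sub n) → (U ⊑ᵇ W) ≡ true → U ⊑ W
⊑ᵇ⇒⊑ {n} U W h v hv with all-allVecs⁻ n _ h v
... | e rewrite hv = e

⊑⇒⊑ᵇ : ∀ {n} (U W : Sub n) → U ⊑ W → (U ⊑ᵇ W) ≡ true
⊑⇒⊑ᵇ {n} U W h = all-allVecs⁺ n _ f
  where
  f : ∀ v → not (U v) ∨ W v ≡ true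
  f v with U v in e
  ... | false = refl
  ... | true = h v e

incidentᵇ⇒incident : ∀ {n} (U W : Sub n) → incidentᵇ U W ≡ true → U ⊑ W ⊎ W ⊑ U
incidentᵇ⇒incident U W h with ∨-true {U ⊑ᵇ W} h
... | inj₁ h₁ = inj₁ (⊑ᵇ⇒⊑ U W h₁)
... | inj₂ h₂ = inj₂ (⊑ᵇ⇒⊑ W U h₂)

⊑⇒incidentᵇ : ∀ {n} (U W : Sub n) → U ⊑ W → incidentᵇ U W ≡ true
⊑⇒incidentᵇ U W h = ∨-trueˡ _ (⊑⇒⊑ᵇ U W h)

⊒⇒incidentᵇ : ∀ {n} (U W : Sub n) → W ⊑ U → incidentᵇ U W ≡ true
⊒⇒incidentᵇ U W h = ∨-trueʳ (U ⊑ᵇ W) (⊑⇒⊑ᵇ W U h)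

incidentᵇ⇒⊑ : ∀ {n} {U W : Sub n} → incidentᵇ U W ≡ true → card n U < card n W → U ⊑ W
incidentᵇ⇒⊑ {n} {U} {W} h lt with incidentᵇ⇒incident U W h
... | inj₁ s = s
... | inj₂ s = ⊥-elim (<⇒≱ lt (card-mono n s))

incidentᵇ⇒⊒ : ∀ {n} {U W : Sub n} → incidentᵇ U W ≡ true → card n W < card n U → W ⊑ U
incidentᵇ⇒⊒ {n} {U} {W} h lt with incidentᵇ⇒incident U W h
... | inj₁ s = ⊥-elim (<⇒≱ lt (card-mono n s))
... | inj₂ s = s

+ˢ⁻ : ∀ {n} (U W : Sub n) v → (U +ˢ W) v ≡ true → ∃ λ u → U u ≡ true × W (v ⊕ u) ≡ true
+ˢ⁻ {n} U W v h = let (u , e) = any-allVecs⁻ n _ h in u , ∧-true e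

+ˢ⁺ : ∀ {n} (U W : Sub n) v u → U u ≡ true → W (v ⊕ u) ≡ true → (U +ˢ W) v ≡ true
+ˢ⁺ {n} U W v u h₁ h₂ = any-allVecs⁺ n _ u (∧-true⁺ h₁ h₂)

+ˢ-isSubspace : ∀ {n} {U W : Sub n} → IsSubspace U → IsSubspace W → IsSubspace (U +ˢ W)
+ˢ-isSubspace {n} {U} {W} (zU , cU) (zW , cW) =
  +ˢ⁺ U W zeroV zeroV zU (subst (λ t → W t ≡ true) (sym (⊕-self zeroV)) zW) ,
  λ x y hx hy → let (u₁ , a₁ , b₁) = +ˢ⁻ U W x hx ; (u₂ , a₂ , b₂) = +ˢ⁻ U W y hy in
    +ˢ⁺ U W (x ⊕ y) (u₁ ⊕ u₂) (cU u₁ u₂ a₁ a₂)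
      (subst (λ t → W t ≡ true) (sym (⊕-interchange x y u₁ u₂)) (cW _ _ b₁ b₂))

+ˢ-least : ∀ {n} {U₁ U₂ W : Sub n} → IsSubspace W → U₁ ⊑ W → U₂ ⊑ W → (U₁ +ˢ U₂) ⊑ W
+ˢ-least {U₁ = U₁} {U₂} {W} (_ , cW) h₁ h₂ v hv = let (u , a , b) = +ˢ⁻ U₁ U₂ v hv in
  subst (λ t → W t ≡ true) (⊕-cancelʳ v u) (cW (v ⊕ u) u (h₂ _ b) (h₁ _ a))

χ-∧ : ∀ a b → χ (a ∧ b) ≡ χ a * χ b
χ-∧ false b = refl
χ-∧ true false = refl
χ-∧ true true = refl

-- Both sides count the pairs (u, s) with u ∈ U and s ⊕ u ∈ W: for fixed s there are
-- |U ∩ W| of them if s ∈ U + W and none otherwise.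
card-+ˢ*card-∩ : ∀ n (U W : Sub n) → IsSubspace U → IsSubspace W →
  card n (U +ˢ W) * card n (U ∩ W) ≡ card n U * card n W
card-+ˢ*card-∩ n U W sU sW = begin
  card n (U +ˢ W) * card n (U ∩ W)                 ≡⟨ sym (∑-*ʳ n (λ s → χ ((U +ˢ W) s)) (card n (U ∩ W))) ⟩
  ∑ n (λ s → χ ((U +ˢ W) s) * card n (U ∩ W))     ≡⟨ ∑-cong n fibre ⟩
  ∑ n (λ s → ∑ n (λ u → χ (U u ∧ W (s ⊕ u))))     ≡⟨ ∑-comm n n (λ s u → χ (U u ∧ W (s ⊕ u))) ⟩
  ∑ n (λ u → ∑ n (λ s → χ (U u ∧ W (s ⊕ u))))     ≡⟨ ∑-cong n row ⟩
  ∑ n (λ u → χ (U u) * card n W)                   ≡⟨ ∑-*ʳ n (λ u → χ (U u)) (card n W) ⟩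
  card n U * card n W                              ∎
  where
  open ≡-Reasoning
  row : ∀ u → ∑ n (λ s → χ (U u ∧ W (s ⊕ u))) ≡ χ (U u) * card n W
  row u = trans (∑-cong n (λ s → χ-∧ (U u) (W (s ⊕ u))))
                (trans (∑-*ˡ n (λ s → χ (W (s ⊕ u))) (χ (U u))) (cong (χ (U u) *_) (card-translate n W u)))
  fibre : ∀ s → χ ((U +ˢ W) s) * card n (U ∩ W) ≡ ∑ n (λ u → χ (U u ∧ W (s ⊕ u)))
  fibre s with (U +ˢ W) s in e
  ... | true = let (u₀ , a , b) = +ˢ⁻ U W s e in
    trans (+-identityʳ _) (sym (trans (sym (∑-translate n (λ u → χ (U u ∧ W (s ⊕ u))) u₀))
      (∑-cong n (λ v → cong χ (cong₂ _∧_ (translate-invariant sU a v)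
         (trans (cong W (trans (sym (⊕-assoc s v u₀)) (trans (cong (_⊕ u₀) (⊕-comm s v)) (⊕-assoc v s u₀))))
                (translate-invariant sW b v)))))))
  ... | false = sym (card-empty n _ f)
    where
    f : ∀ u → U u ∧ W (s ⊕ u) ≡ false
    f u with U u in e₁ | W (s ⊕ u) in e₂
    ... | false | _ = refl
    ... | true | false = refl
    ... | true | true = ⊥-elim (true≢false (trans (sym (+ˢ⁺ U W s u e₁ e₂)) e))

module _ {A : Set} where

  All-filterᵇ⁺ : ∀ {P : A → Set} (p : A → Bool) {xs} → All P xs → All (λ x → P x × p x ≡ true) (filterᵇ p xs)
  All-filterᵇ⁺ p {xs} ps =
    All.zip (All.filter⁺ (T? ∘ p) ps , All.map (Equivalence.to T-≡) (All.all-filter (T? ∘ p) xs))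

  AllPairs-filterᵇ⁺ : ∀ {R : A → A → Set} (p : A → Bool) {xs} → AllPairs R xs → AllPairs R (filterᵇ p xs)
  AllPairs-filterᵇ⁺ p = AllPairs.filter⁺ (T? ∘ p)

  AllPairs-mapWithAll : ∀ {P : A → Set} {R R' : A → A → Set} {xs} → All P xs → AllPairs R xs →
    (∀ {x y} → P x → P y → R x y → R' x y) → AllPairs R' xs
  AllPairs-mapWithAll [] [] f = []
  AllPairs-mapWithAll (px ∷ ps) (rx ∷ rs) f = All.zipWith (λ (py , r) → f px py r) (ps , rx) ∷ AllPairs-mapWithAll ps rs f

  length-filterᵇ-mono : ∀ {P : A → Set} {xs} (p q : A → Bool) → All P xs → (∀ x → P x → p x ≡ true → q x ≡ true) →
    length (filterᵇ p xs) ≤ length (filterᵇ q xs)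
  length-filterᵇ-mono p q [] f = z≤n
  length-filterᵇ-mono {xs = x ∷ xs} p q (px ∷ ps) f with p x in e₁ | q x in e₂
  ... | true | true = s≤s (length-filterᵇ-mono p q ps f)
  ... | true | false = ⊥-elim (true≢false (trans (sym (f x px e₁)) e₂))
  ... | false | true = m≤n⇒m≤1+n (length-filterᵇ-mono p q ps f)
  ... | false | false = length-filterᵇ-mono p q ps f

  length-filterᵇ-∨ : ∀ {P : A → Set} {xs} (p q r : A → Bool) → All P xs →
    (∀ x → P x → p x ≡ true → q x ≡ true ⊎ r x ≡ true) →
    length (filterᵇ p xs) ≤ length (filterᵇ q xs) + length (filterᵇ r xs)
  length-filterᵇ-∨ p q r [] f = z≤n
  length-filterᵇ-∨ {xs = x ∷ xs} p q r (px ∷ ps) f with p x in e₁ | q x in e₂ | r x in e₃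
  ... | false | true | true = ≤-trans IH (≤-trans (m≤n+m _ 1) (s≤s (+-monoʳ-≤ _ (m≤n+m _ 1))))
    where IH = length-filterᵇ-∨ p q r ps f
  ... | false | true | false = m≤n⇒m≤1+n (length-filterᵇ-∨ p q r ps f)
  ... | false | false | true = ≤-trans (length-filterᵇ-∨ p q r ps f) (+-monoʳ-≤ _ (m≤n+m _ 1))
  ... | false | false | false = length-filterᵇ-∨ p q r ps f
  ... | true | true | false = s≤s (length-filterᵇ-∨ p q r ps f)
  ... | true | true | true = s≤s (≤-trans (length-filterᵇ-∨ p q r ps f) (+-monoʳ-≤ _ (m≤n+m _ 1)))
  ... | true | false | true = ≤-trans (s≤s (length-filterᵇ-∨ p q r ps f)) (≤-reflexive (sym (+-suc _ _)))
  ... | true | false | false with f x px e₁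
  ...   | inj₁ h = ⊥-elim (true≢false (trans (sym h) e₂))
  ...   | inj₂ h = ⊥-elim (true≢false (trans (sym h) e₃))

  length-filterᵇ-split : (p q : A → Bool) (xs : List A) → length (filterᵇ p xs) ≡
    length (filterᵇ p (filterᵇ q xs)) + length (filterᵇ p (filterᵇ (λ x → not (q x)) xs))
  length-filterᵇ-split p q [] = refl
  length-filterᵇ-split p q (x ∷ xs) with q x | p x in e
  ... | true | true rewrite e = cong suc (length-filterᵇ-split p q xs)
  ... | true | false rewrite e = length-filterᵇ-split p q xs
  ... | false | true rewrite e = trans (cong suc (length-filterᵇ-split p q xs)) (sym (+-suc _ _))
  ... | false | false rewrite e = length-filterᵇ-split p q xs

  length-split : (q : A → Bool) (xs : List A) → length xs ≡ length (filterᵇ q xs) + length (filterᵇ (λ x → not (q x)) xs)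
  length-split q [] = refl
  length-split q (x ∷ xs) with q x
  ... | true = cong suc (length-split q xs)
  ... | false = trans (cong suc (length-split q xs)) (sym (+-suc _ _))

  length-filterᵇ≤1 : ∀ {P : A → Set} {R : A → A → Set} {xs} (p : A → Bool) → All P xs → AllPairs R xs →
    (∀ x y → P x → P y → R x y → p x ≡ true → p y ≡ true → ⊥) → length (filterᵇ p xs) ≤ 1
  length-filterᵇ≤1 p [] [] f = z≤n
  length-filterᵇ≤1 {xs = x ∷ xs} p (px ∷ ps) (rx ∷ rs) f with p x in e
  ... | false = length-filterᵇ≤1 p ps rs f
  ... | true = s≤s (≤-reflexive (none xs ps rx))
    where
    none : ∀ ys → All _ ys → All _ ys → length (filterᵇ p ys) ≡ 0
    none [] [] [] = refl
    none (y ∷ ys) (py ∷ ps') (r ∷ rs') with p y in e'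
    ... | true = ⊥-elim (f x y px py r e e')
    ... | false = none ys ps' rs'

  ─-keeps : ∀ {P Q : A → Set} (xs : List A) (p : Any P xs) → Any Q xs → (∀ x → P x → Q x → ⊥) → Any Q (xs ─ p)
  ─-keeps (x ∷ xs) (here px) (here qx) d = ⊥-elim (d x px qx)
  ─-keeps (x ∷ xs) (here px) (there q) d = q
  ─-keeps (x ∷ xs) (there p) (here qx) d = here qx
  ─-keeps (x ∷ xs) (there p) (there q) d = there (─-keeps xs p q d)

  AllPairs-Any⇒All : ∀ {P Q : A → Set} {R : A → A → Set} {xs} → AllPairs R xs → Any P xs →
    (∀ {x y} → R x y → R y x) → (∀ x → P x → Q x → ⊥) → All (λ x → Q x → ∃ λ y → P y × R x y) xs
  AllPairs-Any⇒All {xs = x ∷ xs} (rx ∷ rs) (here px) sym' d =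
    (λ qx → ⊥-elim (d x px qx)) ∷ All.map (λ r _ → x , px , sym' r) rx
  AllPairs-Any⇒All {xs = x ∷ xs} (rx ∷ rs) (there p) sym' d =
    (λ _ → let (px , r) = All.lookupAny rx p in _ , r , px) ∷ AllPairs-Any⇒All rs p sym' d

  All-transpose : ∀ {B : Set} {K : A → B → Set} {xs : List A} {ys : List B} →
    All (λ x → All (K x) ys) xs → All (λ y → All (λ x → K x y) xs) ys
  All-transpose {ys = []} _ = []
  All-transpose {ys = y ∷ ys} a = All.map All.head a ∷ All-transpose (All.map All.tail a)

  Any-filterᵇ⁺ : ∀ {P : A → Set} (p : A → Bool) {xs} → Any P xs → (∀ x → P x → p x ≡ true) → Any P (filterᵇ p xs)
  Any-filterᵇ⁺ p {x ∷ xs} (here px) f rewrite f x px = here px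
  Any-filterᵇ⁺ p {x ∷ xs} (there a) f with p x
  ... | true = there (Any-filterᵇ⁺ p a f)
  ... | false = Any-filterᵇ⁺ p a f

  ⋃ : ∀ {n} → (A → Sub n) → List A → Sub n
  ⋃ T [] v = false
  ⋃ T (a ∷ as) v = T a v ∨ ⋃ T as v

  card-⋃-disjoint : ∀ {n k} (T : A → Sub n) {L : List A} →
    AllPairs (λ a b → ∀ v → T a v ≡ true → T b v ≡ true → ⊥) L → All (λ a → k ≤ card n (T a)) L →
    length L * k ≤ card n (⋃ T L)
  card-⋃-disjoint T [] [] = z≤n
  card-⋃-disjoint {n} {k} T {a ∷ L} (d ∷ ds) (h ∷ hs) = begin
    k + length L * k                                                      ≤⟨ +-mono-≤ h (card-⋃-disjoint T ds hs) ⟩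
    card n (T a) + card n (⋃ T L)                                         ≡⟨ sym (card-∨+card-∧ n (T a) (⋃ T L)) ⟩
    card n (⋃ T (a ∷ L)) + card n (λ v → T a v ∧ ⋃ T L v)
      ≡⟨ cong (card n (⋃ T (a ∷ L)) +_) (card-empty n _ (apart L d)) ⟩
    card n (⋃ T (a ∷ L)) + 0                                              ≡⟨ +-identityʳ _ ⟩
    card n (⋃ T (a ∷ L))                                                  ∎
    where
    open ≤-Reasoning
    apart : ∀ L' → All (λ b → ∀ v → T a v ≡ true → T b v ≡ true → ⊥) L' → ∀ v → T a v ∧ ⋃ T L' v ≡ false
    apart [] [] v with T a v
    ... | true = refl
    ... | false = refl
    apart (b ∷ L') (db ∷ dbs) v with T a v in e₁ | T b v in e₂
    ... | false | _ = refl
    ... | true | true = ⊥-elim (db v e₁ e₂)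
    ... | true | false = subst (λ t → t ∧ ⋃ T L' v ≡ false) e₁ (apart L' dbs v)

filterᵇ-map : ∀ {A B : Set} (p : B → Bool) (f : A → B) (xs : List A) →
  filterᵇ p (map f xs) ≡ map f (filterᵇ (λ x → p (f x)) xs)
filterᵇ-map p f [] = refl
filterᵇ-map p f (x ∷ xs) with p (f x)
... | true = cong (f x ∷_) (filterᵇ-map p f xs)
... | false = filterᵇ-map p f xs

≐-trans : ∀ {n} {U V W : Sub n} → U ≐ V → V ≐ W → U ≐ W
≐-trans e e' v = trans (e v) (e' v)

≐-sym : ∀ {n} {U W : Sub n} → U ≐ W → W ≐ U
≐-sym e v = sym (e v)

length-≤-via-injection : ∀ {m n} (f : Sub m → Sub n) → (∀ {U U'} → f U ≐ f U' → U ≐ U') →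
  (As : List (Sub m)) (B : List (Sub n)) → Distinct As → All (λ S → f S ∈ˢ B) As → length As ≤ length B
length-≤-via-injection f f-inj [] B _ _ = z≤n
length-≤-via-injection f f-inj (a ∷ As) B (da ∷ dAs) (pa ∷ pAs) =
  subst (suc (length As) ≤_) (sym (length-removeAt′ B (index pa)))
    (s≤s (length-≤-via-injection f f-inj As (B ─ pa) dAs
      (All.zipWith (λ (a≢S , pS) → ─-keeps B pa pS (λ E e₁ e₂ → a≢S (f-inj (≐-trans e₁ (≐-sym e₂))))) (da , pAs))))

-- a = dim(V + W) and b = dim(V ∩ W) for 4-spaces V and W.
dim∩≤1 : ∀ a b → a + b ≡ 8 → b ≤ 4 → (∀ d → d + b ≡ a → 6 ≤ d) → b ≤ 1
dim∩≤1 a 0 e b≤4 far = z≤n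
dim∩≤1 a 1 e b≤4 far = s≤s z≤n
dim∩≤1 a 2 e b≤4 far = ⊥-elim (<⇒≱ (<ᵇ⇒< 4 6 _) (far 4 (sym (+-cancelʳ-≡ 2 a 6 e))))
dim∩≤1 a 3 e b≤4 far = ⊥-elim (<⇒≱ (<ᵇ⇒< 2 6 _) (far 2 (sym (+-cancelʳ-≡ 3 a 5 e))))
dim∩≤1 a 4 e b≤4 far = ⊥-elim (<⇒≱ (<ᵇ⇒< 0 6 _) (far 0 (sym (+-cancelʳ-≡ 4 a 4 e))))
dim∩≤1 a (suc (suc (suc (suc (suc b))))) e (s≤s (s≤s (s≤s (s≤s ()))))

AlmostDisjoint : ∀ {n} → Sub n → Sub n → Set
AlmostDisjoint {n} V W = card n (V ∩ W) ≤ 2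

AlmostDisjoint-sym : ∀ {n} {V W : Sub n} → AlmostDisjoint V W → AlmostDisjoint W V
AlmostDisjoint-sym {n} {V} {W} r = subst (_≤ 2) (card-cong n (λ v → ∧-comm (V v) (W v))) r

dimensions-far⇒AlmostDisjoint : ∀ {n a b} {V W : Sub n} → HasDim V 4 → HasDim W 4 →
  (∀ d → SubspaceDist V W d → 6 ≤ d) → HasDim (V +ˢ W) a → HasDim (V ∩ W) b → AlmostDisjoint V W
dimensions-far⇒AlmostDisjoint {n} {a} {b} {V} {W} dV dW far dSum dMeet =
  subst (_≤ 2) (sym (hasDim⇒card dMeet)) (^-monoʳ-≤ 2 b≤1)
  where
  a+b≡8 : 2 ^ (a + b) ≡ 2 ^ 8
  a+b≡8 = begin
    2 ^ (a + b)                      ≡⟨ ^-distribˡ-+-* 2 a b ⟩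
    2 ^ a * 2 ^ b                    ≡⟨ sym (cong₂ _*_ (hasDim⇒card dSum) (hasDim⇒card dMeet)) ⟩
    card n (V +ˢ W) * card n (V ∩ W) ≡⟨ card-+ˢ*card-∩ n V W (hasDim⇒isSubspace dV) (hasDim⇒isSubspace dW) ⟩
    card n V * card n W              ≡⟨ cong₂ _*_ (hasDim⇒card dV) (hasDim⇒card dW) ⟩
    2 ^ 8                            ∎
    where open ≡-Reasoning
  b≤4 : b ≤ 4
  b≤4 = 2^-cancel-≤ b 4 (subst₂ _≤_ (hasDim⇒card dMeet) (hasDim⇒card dV) (card-mono n (λ v hv → proj₁ (∧-true hv))))
  b≤1 : b ≤ 1
  b≤1 = dim∩≤1 a b (2^-injective (a + b) 8 a+b≡8) b≤4 (λ d eq → far d (a , b , dSum , dMeet , eq))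

dist≥6⇒AlmostDisjoint : ∀ {n} {V W : Sub n} → HasDim V 4 → HasDim W 4 → (∀ d → SubspaceDist V W d → 6 ≤ d) →
  AlmostDisjoint V W
dist≥6⇒AlmostDisjoint {n} {V} {W} dV dW far = dimensions-far⇒AlmostDisjoint dV dW far
  (proj₂ (isSubspace⇒hasDim n (V +ˢ W) (+ˢ-isSubspace sV sW))) (proj₂ (isSubspace⇒hasDim n (V ∩ W) (∩-isSubspace sV sW)))
  where
  sV = hasDim⇒isSubspace dV
  sW = hasDim⇒isSubspace dW

-- The hyperplane Ĥ = {x : xₙ₊₁ = 0} of F₂ⁿ⁺¹ and traces on it

Ĥ : ∀ {n} → Sub (suc n)
Ĥ v = not (last v)

trace : ∀ {n} → Sub (suc n) → Sub n
trace V u = V (u ∷ʳ false)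

Ĥ-isSubspace : ∀ {n} → IsSubspace (Ĥ {n})
Ĥ-isSubspace {n} = cong not (last-zeroV n) ,
  λ x y hx hy → cong not (trans (last-⊕ x y) (cong₂ _xor_ (not-true hx) (not-true hy)))

Ĥ-hasDim : ∀ {n} → HasDim (Ĥ {n}) n
Ĥ-hasDim {n} = card⇒hasDim Ĥ-isSubspace (begin
  card (suc n) Ĥ                                                   ≡⟨ card-∷ʳ n Ĥ ⟩
  card n (λ u → not (last (u ∷ʳ false))) + card n (λ u → not (last (u ∷ʳ true)))
    ≡⟨ cong₂ _+_ (card-full n _ (λ u → cong not (last-∷ʳ false u))) (card-empty n _ (λ u → cong not (last-∷ʳ true u))) ⟩
  2 ^ n + 0                                                        ≡⟨ +-identityʳ _ ⟩
  2 ^ n                                                            ∎)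
  where open ≡-Reasoning

card-trace≤ : ∀ n (V : Sub (suc n)) → card n (trace V) ≤ card (suc n) V
card-trace≤ n V = subst (card n (trace V) ≤_) (sym (card-∷ʳ n V)) (m≤m+n _ _)

trace-isSubspace : ∀ {n} {V : Sub (suc n)} → IsSubspace V → IsSubspace (trace V)
trace-isSubspace {n} {V} (z , closed) = subst (λ t → V t ≡ true) (zeroV-∷ʳ n) z ,
  λ x y hx hy → subst (λ t → V t ≡ true) (∷ʳ-⊕ x y false false) (closed _ _ hx hy)

card-trace-∩≤ : ∀ {n} {V W : Sub (suc n)} → AlmostDisjoint V W → ∀ (U : Sub n) →
  U ⊑ trace V → U ⊑ trace W → card n U ≤ 2
card-trace-∩≤ {n} {V} {W} r U h₁ h₂ =
  ≤-trans (card-mono n {U} {trace (V ∩ W)} (λ u hu → ∧-true⁺ (h₁ u hu) (h₂ u hu))) (≤-trans (card-trace≤ n (V ∩ W)) r)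

∷ʳ-true-as-⊕ : ∀ {n} (u : F2^ n) {x : F2^ (suc n)} → last x ≡ true → (u ∷ʳ true) ⊕ x ≡ (u ⊕ init x) ∷ʳ false
∷ʳ-true-as-⊕ u {x} lx =
  trans (cong ((u ∷ʳ true) ⊕_) (trans (init-∷ʳ-last x) (cong (init x ∷ʳ_) lx))) (∷ʳ-⊕ u (init x) true true)

-- A subspace with a vector x off Ĥ is (trace V) ∪ (trace V + x).
card≡2*card-trace : ∀ {n} {V : Sub (suc n)} → IsSubspace V → ∀ {x} → V x ≡ true → last x ≡ true →
  card (suc n) V ≡ 2 * card n (trace V)
card≡2*card-trace {n} {V} sV {x} hx lx = begin
  card (suc n) V                                           ≡⟨ card-∷ʳ n V ⟩
  card n (trace V) + card n (λ u → V (u ∷ʳ true))          ≡⟨ cong (card n (trace V) +_) upper ⟩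
  card n (trace V) + card n (trace V)                      ≡⟨ cong (card n (trace V) +_) (sym (+-identityʳ _)) ⟩
  2 * card n (trace V)                                     ∎
  where
  open ≡-Reasoning
  upper : card n (λ u → V (u ∷ʳ true)) ≡ card n (trace V)
  upper = trans (card-cong n (λ u → trans (sym (translate-invariant sV hx (u ∷ʳ true))) (cong V (∷ʳ-true-as-⊕ u lx))))
                (card-translate n (trace V) (init x))

outsideĤᵇ : ∀ {n} → Sub (suc n) → Bool
outsideĤᵇ V = not (V ⊑ᵇ Ĥ)

-- Junk value zeroV when V ⊑ Ĥ.
apex : ∀ {n} → Sub (suc n) → F2^ (suc n)
apex {n} V with search (suc n) (λ v → V v ∧ last v)
... | inj₁ (v , _) = v
... | inj₂ _ = zeroV

apex-spec : ∀ {n} {V : Sub (suc n)} → outsideĤᵇ V ≡ true → V (apex V) ≡ true × last (apex V) ≡ true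
apex-spec {n} {V} out with search (suc n) (λ v → V v ∧ last v)
... | inj₁ (v , e) = ∧-true e
... | inj₂ none = ⊥-elim (true≢false (trans (sym out) (cong not (⊑⇒⊑ᵇ V Ĥ inĤ))))
  where
  inĤ : V ⊑ Ĥ
  inĤ v hv with last v in e
  ... | false = refl
  ... | true = ⊥-elim (true≢false (trans (sym (∧-true⁺ hv e)) (none v)))

card-trace : ∀ {n k} {V : Sub (suc n)} → HasDim V (suc k) → outsideĤᵇ V ≡ true → card n (trace V) ≡ 2 ^ k
card-trace {n} {k} {V} dV out = *-cancelˡ-≡ _ _ 2 (begin
  2 * card n (trace V)  ≡⟨ sym (card≡2*card-trace (hasDim⇒isSubspace dV) (proj₁ apex∈V) (proj₂ apex∈V)) ⟩
  card (suc n) V        ≡⟨ hasDim⇒card dV ⟩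
  2 * 2 ^ k             ∎)
  where
  open ≡-Reasoning
  apex∈V = apex-spec {V = V} out

trace-hasDim : ∀ {n k} {V : Sub (suc n)} → HasDim V (suc k) → outsideĤᵇ V ≡ true → HasDim (trace V) k
trace-hasDim dV out = card⇒hasDim (trace-isSubspace (hasDim⇒isSubspace dV)) (card-trace dV out)

ι-∷ʳ : ∀ (S : Sub 7) u b → ι S (u ∷ʳ b) ≡ not b ∧ S u
ι-∷ʳ S u b rewrite last-∷ʳ b u | init-∷ʳ b u = refl

trace-ι : ∀ (S : Sub 7) u → trace (ι S) u ≡ S u
trace-ι S u = ι-∷ʳ S u false

card-ι : ∀ (S : Sub 7) → card 8 (ι S) ≡ card 7 S
card-ι S = trans (card-∷ʳ 7 (ι S))
  (trans (cong₂ _+_ (card-cong 7 (trace-ι S)) (card-empty 7 _ (λ u → ι-∷ʳ S u true))) (+-identityʳ _))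

ι-isSubspace : ∀ {S : Sub 7} → IsSubspace S → IsSubspace (ι S)
ι-isSubspace {S} (z , closed) = z ,
  ∷ʳ-elim _ λ u a → ∷ʳ-elim _ λ w b → λ hx hy →
    trans (cong (ι S) (∷ʳ-⊕ u w a b))
      (trans (ι-∷ʳ S (u ⊕ w) (a xor b)) (both-in-Ĥ a b (trans (sym (ι-∷ʳ S u a)) hx) (trans (sym (ι-∷ʳ S w b)) hy)))
  where
  both-in-Ĥ : ∀ a b {u w} → not a ∧ S u ≡ true → not b ∧ S w ≡ true → not (a xor b) ∧ S (u ⊕ w) ≡ true
  both-in-Ĥ false false hx hy = closed _ _ hx hy

ι-hasDim : ∀ {S : Sub 7} {k} → HasDim S k → HasDim (ι S) k
ι-hasDim {S} d = card⇒hasDim (ι-isSubspace (hasDim⇒isSubspace d)) (trans (card-ι S) (hasDim⇒card d))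

ι⊑Ĥ : ∀ (S : Sub 7) → ι S ⊑ Ĥ
ι⊑Ĥ S v h = proj₁ (∧-true h)

ι-injective : ∀ {S S' : Sub 7} → ι S ≐ ι S' → S ≐ S'
ι-injective {S} {S'} e u = trans (sym (trace-ι S u)) (trans (e (u ∷ʳ false)) (trace-ι S' u))

ι-mono : ∀ {S S' : Sub 7} → S ⊑ S' → ι S ⊑ ι S'
ι-mono h v hv = ∧-true⁺ (proj₁ (∧-true hv)) (h _ (proj₂ (∧-true hv)))

ι⊑ : ∀ {S : Sub 7} {V : Sub 8} → S ⊑ trace V → ι S ⊑ V
ι⊑ {S} {V} s = ∷ʳ-elim _ f
  where
  f : ∀ u b → ι S (u ∷ʳ b) ≡ true → V (u ∷ʳ b) ≡ true
  f u false h = s u (trans (sym (trace-ι S u)) h)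
  f u true h = ⊥-elim (true≢false (sym (trans (sym (ι-∷ʳ S u true)) h)))

incident⇒⊑ : ∀ {n a b} {U W : Sub n} → HasDim U a → HasDim W b → a < b → incidentᵇ U W ≡ true → U ⊑ W
incident⇒⊑ dU dW a<b h =
  incidentᵇ⇒⊑ h (subst₂ _<_ (sym (hasDim⇒card dU)) (sym (hasDim⇒card dW)) (^-monoʳ-< 2 (s≤s (s≤s z≤n)) a<b))

incident⇒⊒ : ∀ {n a b} {U W : Sub n} → HasDim U a → HasDim W b → b < a → incidentᵇ U W ≡ true → W ⊑ U
incident⇒⊒ dU dW b<a h =
  incidentᵇ⇒⊒ h (subst₂ _<_ (sym (hasDim⇒card dW)) (sym (hasDim⇒card dU)) (^-monoʳ-< 2 (s≤s (s≤s z≤n)) b<a))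

card*card≤card*2 : ∀ n {U₁ U₂ W : Sub n} → IsSubspace U₁ → IsSubspace U₂ → IsSubspace W →
  AlmostDisjoint U₁ U₂ → U₁ ⊑ W → U₂ ⊑ W → card n U₁ * card n U₂ ≤ card n W * 2
card*card≤card*2 n {U₁} {U₂} {W} s₁ s₂ sW r h₁ h₂ = begin
  card n U₁ * card n U₂                   ≡⟨ sym (card-+ˢ*card-∩ n U₁ U₂ s₁ s₂) ⟩
  card n (U₁ +ˢ U₂) * card n (U₁ ∩ U₂)    ≤⟨ *-mono-≤ (card-mono n (+ˢ-least sW h₁ h₂)) r ⟩
  card n W * 2                            ∎
  where open ≤-Reasoning

∃-outside : ∀ {n k} {W : Sub n} → HasDim W k → k < n → ∃ λ z → W z ≡ false
∃-outside {n} {k} {W} dW k<n with search n (λ u → not (W u))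
... | inj₁ (z , e) = z , not-true e
... | inj₂ none = ⊥-elim (<⇒≢ (^-monoʳ-< 2 (s≤s (s≤s z≤n)) k<n)
                    (trans (sym (hasDim⇒card dW)) (card-full n W (λ u → not-false (none u)))))

-- A hyperplane W and its translate W + z are disjoint and together have 2ⁿ⁺¹ elements.
hyperplane-cover : ∀ {n} {W : Sub (suc n)} → HasDim W n → ∀ {z} → W z ≡ false → ∀ u → W u ≡ true ⊎ W (u ⊕ z) ≡ true
hyperplane-cover {n} {W} dW {z} wz u = ∨-true (card≡2^n⇒full (suc n) _ (+-cancelʳ-≡ _ _ _ (begin
  card (suc n) (λ v → W v ∨ W (v ⊕ z)) + card (suc n) (λ v → W v ∧ W (v ⊕ z))  ≡⟨ card-∨+card-∧ (suc n) W (λ v → W (v ⊕ z)) ⟩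
  card (suc n) W + card (suc n) (λ v → W (v ⊕ z))                              ≡⟨ cong₂ _+_ cW (trans (card-translate (suc n) W z) cW) ⟩
  2 ^ n + 2 ^ n                                                                ≡⟨ cong (2 ^ n +_) (sym (+-identityʳ (2 ^ n))) ⟩
  2 ^ suc n                                                                    ≡⟨ sym (+-identityʳ _) ⟩
  2 ^ suc n + 0                                                                ≡⟨ cong (2 ^ suc n +_) (sym (card-empty (suc n) _ apart)) ⟩
  2 ^ suc n + card (suc n) (λ v → W v ∧ W (v ⊕ z))                             ∎)) u)
  where
  open ≡-Reasoning
  cW = hasDim⇒card dW
  sW = hasDim⇒isSubspace dW
  apart : ∀ v → W v ∧ W (v ⊕ z) ≡ false
  apart v with W v in e₁ | W (v ⊕ z) in e₂
  ... | false | _ = refl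
  ... | true | false = refl
  ... | true | true =
    ⊥-elim (true≢false (trans (sym (subst (λ t → W t ≡ true) (⊕-cancelˡ v z) (proj₂ sW v (v ⊕ z) e₁ e₂))) wz))

_·_ : ∀ {n} → Bool → F2^ n → F2^ n
true · a = a
false · a = zeroV

·-⊕ : ∀ {n} b₁ b₂ (a : F2^ n) → (b₁ · a) ⊕ (b₂ · a) ≡ (b₁ xor b₂) · a
·-⊕ false false a = ⊕-self zeroV
·-⊕ false true a = ⊕-identityˡ a
·-⊕ true false a = ⊕-identityʳ a
·-⊕ true true a = ⊕-self a

-- extend W a is the subspace ι W + ⟨(a, 1)⟩ of F₂ⁿ⁺¹.
extend : ∀ {n} → Sub n → F2^ n → Sub (suc n)
extend W a v = W (init v ⊕ (last v · a))

extend-∷ʳ : ∀ {n} (W : Sub n) a u b → extend W a (u ∷ʳ b) ≡ W (u ⊕ (b · a))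
extend-∷ʳ W a u b rewrite last-∷ʳ b u | init-∷ʳ b u = refl

extend-isSubspace : ∀ {n} {W : Sub n} a → IsSubspace W → IsSubspace (extend W a)
extend-isSubspace {n} {W} a (z , closed) =
  trans (cong (extend W a) (zeroV-∷ʳ n)) (trans (extend-∷ʳ W a zeroV false) (trans (cong W (⊕-self zeroV)) z)) ,
  ∷ʳ-elim _ λ u b₁ → ∷ʳ-elim _ λ w b₂ → λ hx hy →
    trans (cong (extend W a) (∷ʳ-⊕ u w b₁ b₂)) (trans (extend-∷ʳ W a (u ⊕ w) (b₁ xor b₂))
      (subst (λ t → W t ≡ true) (trans (⊕-interchange u (b₁ · a) w (b₂ · a)) (cong ((u ⊕ w) ⊕_) (·-⊕ b₁ b₂ a)))
        (closed _ _ (trans (sym (extend-∷ʳ W a u b₁)) hx) (trans (sym (extend-∷ʳ W a w b₂)) hy))))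

card-extend : ∀ {n} (W : Sub n) a → card (suc n) (extend W a) ≡ card n W + card n W
card-extend {n} W a = trans (card-∷ʳ n (extend W a)) (cong₂ _+_
  (card-cong n (λ u → trans (extend-∷ʳ W a u false) (cong W (⊕-identityʳ u))))
  (trans (card-cong n (λ u → extend-∷ʳ W a u true)) (card-translate n W a)))

extend-hasDim : ∀ {n k} {W : Sub n} a → HasDim W k → HasDim (extend W a) (suc k)
extend-hasDim {k = k} {W} a dW = card⇒hasDim (extend-isSubspace a (hasDim⇒isSubspace dW))
  (trans (card-extend W a) (trans (cong₂ _+_ (hasDim⇒card dW) (hasDim⇒card dW)) (cong (2 ^ k +_) (sym (+-identityʳ (2 ^ k))))))

-- V = trace V + ⟨x⟩ with trace V ⊑ W and init x ∈ W + a.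
⊑extend : ∀ {n} {V : Sub (suc n)} {W : Sub n} {a x} → IsSubspace V → IsSubspace W → trace V ⊑ W →
  V x ≡ true → last x ≡ true → W (init x ⊕ a) ≡ true → V ⊑ extend W a
⊑extend {V = V} {W} {a} {x} sV (_ , closedW) tr hx lx ha = ∷ʳ-elim _ f
  where
  f : ∀ u b → V (u ∷ʳ b) ≡ true → extend W a (u ∷ʳ b) ≡ true
  f u false hv = trans (extend-∷ʳ W a u false) (trans (cong W (⊕-identityʳ u)) (tr u hv))
  f u true hv = trans (extend-∷ʳ W a u true) (subst (λ t → W t ≡ true) regroup (closedW _ _ (tr (u ⊕ init x) hv') ha))
    where
    hv' : V ((u ⊕ init x) ∷ʳ false) ≡ true
    hv' = subst (λ t → V t ≡ true) (∷ʳ-true-as-⊕ u lx) (proj₂ sV _ _ hv hx)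
    regroup : (u ⊕ init x) ⊕ (init x ⊕ a) ≡ u ⊕ a
    regroup = trans (⊕-assoc u (init x) _) (cong (u ⊕_) (⊕-cancelˡ (init x) a))

ι⊑extend : ∀ {S W : Sub 7} a → S ⊑ W → ι S ⊑ extend W a
ι⊑extend {S} {W} a s = ∷ʳ-elim _ f
  where
  f : ∀ u b → ι S (u ∷ʳ b) ≡ true → extend W a (u ∷ʳ b) ≡ true
  f u false h = trans (extend-∷ʳ W a u false) (trans (cong W (⊕-identityʳ u)) (s u (trans (sym (trace-ι S u)) h)))
  f u true h = ⊥-elim (true≢false (sym (trans (sym (ι-∷ʳ S u true)) h)))

-- The code C and the candidate solution X

Transversal : Sub 8 → Set
Transversal V = HasDim V 4 × outsideĤᵇ V ≡ true

module _ {V : Sub 8} (t : Transversal V) where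

  transversal-isSubspace : IsSubspace V
  transversal-isSubspace = hasDim⇒isSubspace (proj₁ t)

  transversal-trace-hasDim : HasDim (trace V) 3
  transversal-trace-hasDim = trace-hasDim (proj₁ t) (proj₂ t)

  transversal-card-trace : card 7 (trace V) ≡ 8
  transversal-card-trace = hasDim⇒card transversal-trace-hasDim

  transversal-trace-isSubspace : IsSubspace (trace V)
  transversal-trace-isSubspace = hasDim⇒isSubspace transversal-trace-hasDim

-- (offset V , 1) ∈ V when V is transversal.
offset : Sub 8 → F2^ 7
offset V = init (apex V)

transversal-⊑extend : ∀ {V : Sub 8} {W : Sub 7} {a} → Transversal V → IsSubspace W → trace V ⊑ W →
  W (offset V ⊕ a) ≡ true → V ⊑ extend W a
transversal-⊑extend {V} t@(_ , out) sW tr h =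
  ⊑extend (transversal-isSubspace t) sW tr (proj₁ (apex-spec {V = V} out)) (proj₂ (apex-spec {V = V} out)) h

traces-almostDisjoint : ∀ {V₁ V₂ : Sub 8} → AlmostDisjoint V₁ V₂ → AlmostDisjoint (trace V₁) (trace V₂)
traces-almostDisjoint {V₁} {V₂} r = ≤-trans (card-trace≤ 7 (V₁ ∩ V₂)) r

-- If the offsets shared a coset, V₁ and V₂ would both lie in the 6-space extend W (offset V₁),
-- too small for two almost disjoint 4-spaces.
offsets-in-distinct-cosets : ∀ {W : Sub 7} → HasDim W 5 → ∀ {V₁ V₂} → Transversal V₁ → Transversal V₂ →
  AlmostDisjoint V₁ V₂ → trace V₁ ⊑ W → trace V₂ ⊑ W →
  ∀ u → W (u ⊕ offset V₁) ≡ true → W (u ⊕ offset V₂) ≡ true → ⊥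
offsets-in-distinct-cosets {W} dW {V₁} {V₂} t₁ t₂ r tr₁ tr₂ u h₁ h₂ = <⇒≱ (<ᵇ⇒< 128 256 _) (begin
  256                                ≡⟨ sym (cong₂ _*_ (hasDim⇒card (proj₁ t₁)) (hasDim⇒card (proj₁ t₂))) ⟩
  card 8 V₁ * card 8 V₂              ≤⟨ card*card≤card*2 8 (transversal-isSubspace t₁) (transversal-isSubspace t₂)
                                          (extend-isSubspace x₁ sW) r V₁⊑ V₂⊑ ⟩
  card 8 (extend W x₁) * 2           ≡⟨ cong₂ _*_ card-extend-W refl ⟩
  128                                ∎)
  where
  x₁ = offset V₁
  x₂ = offset V₂
  sW = hasDim⇒isSubspace dW
  open ≤-Reasoning
  card-extend-W : card 8 (extend W x₁) ≡ 64
  card-extend-W = hasDim⇒card (extend-hasDim x₁ dW)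
  x₁⊕x₂∈W : W (x₁ ⊕ x₂) ≡ true
  x₁⊕x₂∈W = subst (λ t → W t ≡ true)
    (trans (⊕-interchange u x₁ u x₂) (trans (cong (_⊕ (x₁ ⊕ x₂)) (⊕-self u)) (⊕-identityˡ _))) (proj₂ sW _ _ h₁ h₂)
  V₁⊑ : V₁ ⊑ extend W x₁
  V₁⊑ = transversal-⊑extend t₁ sW tr₁ (subst (λ t → W t ≡ true) (sym (⊕-self x₁)) (proj₁ sW))
  V₂⊑ : V₂ ⊑ extend W x₁
  V₂⊑ = transversal-⊑extend t₂ sW tr₂ (subst (λ t → W t ≡ true) (⊕-comm x₁ x₂) x₁⊕x₂∈W)

*32≤128⇒≤4 : ∀ m → m * 32 ≤ 128 → m ≤ 4
*32≤128⇒≤4 m h with m ≤? 4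
... | yes m≤4 = m≤4
... | no m≰4 = ⊥-elim (<⇒≱ (<ᵇ⇒< 128 160 _) (≤-trans (*-monoˡ-≤ 32 (≰⇒> m≰4)) h))

module Code (F : List (Sub 7)) (hF : All (λ S → HasDim S 4) F) (dF : Distinct F)
            (C : List (Sub 8)) (hC : All (λ U → HasDim U 4) C)
            (far : AllPairs (λ U W → ∀ d → SubspaceDist U W d → 6 ≤ d) C)
            (inC : All (λ S → ι S ∈ˢ C) F)
            (points : ∀ P → HasDim P 1 → countInc P C ≤ length F)
            (hyperplanes : ∀ H → HasDim H 7 → countInc H C ≤ length F) where

  insideĤᵇ : Sub 8 → Bool
  insideĤᵇ V = V ⊑ᵇ Ĥ

  Cᵢₙ : List (Sub 8)
  Cᵢₙ = filterᵇ insideĤᵇ C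

  Cₒᵤₜ : List (Sub 8)
  Cₒᵤₜ = filterᵇ outsideĤᵇ C

  X : List (Sub 7)
  X = map trace Cₒᵤₜ

  transversal : All Transversal Cₒᵤₜ
  transversal = All-filterᵇ⁺ outsideĤᵇ hC

  almostDisjoint : AllPairs AlmostDisjoint C
  almostDisjoint = AllPairs-mapWithAll hC far dist≥6⇒AlmostDisjoint

  almostDisjointₒᵤₜ : AllPairs AlmostDisjoint Cₒᵤₜ
  almostDisjointₒᵤₜ = AllPairs-filterᵇ⁺ outsideĤᵇ almostDisjoint

  X-distinct : Distinct X
  X-distinct = AllPairs.map⁺ (AllPairs-mapWithAll transversal almostDisjointₒᵤₜ distinct)
    where
    distinct : ∀ {V₁ V₂} → Transversal V₁ → Transversal V₂ → AlmostDisjoint V₁ V₂ → ¬ (trace V₁ ≐ trace V₂)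
    distinct {V₁} {V₂} t₁ t₂ r eq = <⇒≱ (<ᵇ⇒< 2 8 _)
      (subst (_≤ 2) (transversal-card-trace t₁)
        (card-trace-∩≤ {V = V₁} {W = V₂} r (trace V₁) (λ u h → h) (λ u h → trans (sym (eq u)) h)))

  X-almostDisjoint : AllPairs (λ U₁ U₂ → DimAtMost (U₁ ∩ U₂) 1) X
  X-almostDisjoint = AllPairs.map⁺ (AllPairs-mapWithAll transversal almostDisjointₒᵤₜ meet)
    where
    meet : ∀ {V₁ V₂} → Transversal V₁ → Transversal V₂ → AlmostDisjoint V₁ V₂ → DimAtMost (trace V₁ ∩ trace V₂) 1
    meet {V₁} {V₂} t₁ t₂ r =
      card≤2⇒dimAtMost1 (∩-isSubspace (transversal-trace-isSubspace t₁) (transversal-trace-isSubspace t₂))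
                        (traces-almostDisjoint {V₁} {V₂} r)

  ι-insideĤ : ∀ S E → ι S ≐ E → insideĤᵇ E ≡ true
  ι-insideĤ S E e = ⊑⇒⊑ᵇ E Ĥ (λ v hv → ι⊑Ĥ S v (trans (e v) hv))

  -- The copy of S in C lies in Ĥ, so it is a different codeword from any V off Ĥ.
  almostDisjoint-ιF : All (λ S → All (λ V → outsideĤᵇ V ≡ true → ∃ λ E → (ι S ≐ E) × AlmostDisjoint V E) C) F
  almostDisjoint-ιF = All.map
    (λ {S} inS → AllPairs-Any⇒All almostDisjoint inS (λ {V} {W} → AlmostDisjoint-sym {V = V} {W}) (copy-inside S)) inC
    where
    copy-inside : ∀ S E → ι S ≐ E → outsideĤᵇ E ≡ true → ⊥
    copy-inside S E e out = true≢false (trans (sym out) (cong not (ι-insideĤ S E e)))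

  trace∩-dimAtMost1 : ∀ {V S} → Transversal V → HasDim S 4 → (∃ λ E → (ι S ≐ E) × AlmostDisjoint V E) →
    DimAtMost (trace V ∩ S) 1
  trace∩-dimAtMost1 {V} {S} t dS (E , e , r) =
    card≤2⇒dimAtMost1 (∩-isSubspace (transversal-trace-isSubspace t) (hasDim⇒isSubspace dS))
      (≤-trans (≤-reflexive (card-cong 7 (λ u → cong (V (u ∷ʳ false) ∧_) (trans (sym (trace-ι S u)) (e (u ∷ʳ false))))))
               (≤-trans (card-trace≤ 7 (V ∩ E)) r))

  X-inVar : All (InVar F) X
  X-inVar = All.map⁺ (All.map inVar (All-filterᵇ⁺ outsideĤᵇ (All.zip (hC , All-transpose almostDisjoint-ιF))))
    where
    inVar : ∀ {V} → (HasDim V 4 × All (λ S → outsideĤᵇ V ≡ true → ∃ λ E → (ι S ≐ E) × AlmostDisjoint V E) F) ×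
      outsideĤᵇ V ≡ true → InVar F (trace V)
    inVar {V} ((d , meets) , out) = transversal-trace-hasDim (d , out) ,
      All.zipWith (λ {S} (meet , dS) → trace∩-dimAtMost1 {V} {S} (d , out) dS (meet out)) (meets , hF)

  countInc-X : ∀ W → countInc W X ≡ length (filterᵇ (λ V → incidentᵇ (trace V) W) Cₒᵤₜ)
  countInc-X W = trans (cong length (filterᵇ-map (λ U → incidentᵇ U W) trace Cₒᵤₜ))
                       (length-map trace (filterᵇ (λ V → incidentᵇ (trace V) W) Cₒᵤₜ))

  countInc-C : ∀ Z → countInc Z C ≡ countInc Z Cᵢₙ + countInc Z Cₒᵤₜ
  countInc-C Z = length-filterᵇ-split (λ V → incidentᵇ V Z) insideĤᵇ C

  countInc-F≤countInc-Cᵢₙ : ∀ (p : Sub 7 → Bool) Z → (∀ S → HasDim S 4 → p S ≡ true → ι S ⊑ Z ⊎ Z ⊑ ι S) →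
    length (filterᵇ p F) ≤ countInc Z Cᵢₙ
  countInc-F≤countInc-Cᵢₙ p Z incident = length-≤-via-injection ι ι-injective (filterᵇ p F) _ (AllPairs-filterᵇ⁺ p dF)
    (All.map (λ {S} ((dS , inS) , pS) →
                Any-filterᵇ⁺ _ (Any-filterᵇ⁺ insideĤᵇ inS (ι-insideĤ S)) (λ E → copy {S} {E} (incident S dS pS)))
             (All-filterᵇ⁺ p (All.zip (hF , inC))))
    where
    copy : ∀ {S E} → ι S ⊑ Z ⊎ Z ⊑ ι S → ι S ≐ E → incidentᵇ E Z ≡ true
    copy {E = E} (inj₁ s) e = ⊑⇒incidentᵇ E Z (λ v hv → s v (trans (e v) hv))
    copy {E = E} (inj₂ s) e = ⊒⇒incidentᵇ E Z (λ v hv → trans (sym (e v)) (s v hv))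


  length-C≤ : length C ≤ length X + length F
  length-C≤ = begin
    length C                  ≡⟨ length-split insideĤᵇ C ⟩
    length Cᵢₙ + length Cₒᵤₜ  ≡⟨ +-comm (length Cᵢₙ) _ ⟩
    length Cₒᵤₜ + length Cᵢₙ  ≤⟨ +-mono-≤ (≤-reflexive (sym (length-map trace Cₒᵤₜ))) Cᵢₙ≤F ⟩
    length X + length F       ∎
    where
    open ≤-Reasoning
    Cᵢₙ≤F : length Cᵢₙ ≤ length F
    Cᵢₙ≤F = ≤-trans (length-filterᵇ-mono insideĤᵇ (λ V → incidentᵇ V Ĥ) hC (λ V _ h → ∨-trueˡ _ h))
                    (hyperplanes Ĥ Ĥ-hasDim)

  constraint-i : ∀ W → HasDim W 1 → countInc W X ≤ length F ∸ countInc W F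
  constraint-i W dW = m+n≤o⇒m≤o∸n (countInc W X) (begin
    countInc W X + countInc W F                  ≤⟨ +-mono-≤ fromX fromF ⟩
    countInc (ι W) Cₒᵤₜ + countInc (ι W) Cᵢₙ    ≡⟨ +-comm (countInc (ι W) Cₒᵤₜ) _ ⟩
    countInc (ι W) Cᵢₙ + countInc (ι W) Cₒᵤₜ    ≡⟨ sym (countInc-C (ι W)) ⟩
    countInc (ι W) C                             ≤⟨ points (ι W) (ι-hasDim dW) ⟩
    length F                                     ∎)
    where
    open ≤-Reasoning
    fromX : countInc W X ≤ countInc (ι W) Cₒᵤₜ
    fromX = subst (_≤ countInc (ι W) Cₒᵤₜ) (sym (countInc-X W)) (length-filterᵇ-mono _ _ transversal
      (λ V t h → ⊒⇒incidentᵇ V (ι W) (ι⊑ (incident⇒⊒ (transversal-trace-hasDim t) dW (<ᵇ⇒< 1 3 _) h))))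
    fromF : countInc W F ≤ countInc (ι W) Cᵢₙ
    fromF = countInc-F≤countInc-Cᵢₙ (λ S → incidentᵇ S W) (ι W)
      (λ S dS h → inj₂ (ι-mono (incident⇒⊒ dS dW (<ᵇ⇒< 1 4 _) h)))

  constraint-ii : ∀ W → HasDim W 2 → countInc W X ≤ 1
  constraint-ii W dW = subst (_≤ 1) (sym (countInc-X W)) (length-filterᵇ≤1 _ transversal almostDisjointₒᵤₜ both)
    where
    both : ∀ V₁ V₂ → Transversal V₁ → Transversal V₂ → AlmostDisjoint V₁ V₂ →
      incidentᵇ (trace V₁) W ≡ true → incidentᵇ (trace V₂) W ≡ true → ⊥
    both V₁ V₂ t₁ t₂ r h₁ h₂ = <⇒≱ (<ᵇ⇒< 2 4 _) (subst (_≤ 2) (hasDim⇒card dW)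
      (card-trace-∩≤ {V = V₁} {W = V₂} r W (incident⇒⊒ (transversal-trace-hasDim t₁) dW (<ᵇ⇒< 2 3 _) h₁)
                                            (incident⇒⊒ (transversal-trace-hasDim t₂) dW (<ᵇ⇒< 2 3 _) h₂)))

  constraint-iii : ∀ W → HasDim W 4 → countInc W X ≤ 1
  constraint-iii W dW = subst (_≤ 1) (sym (countInc-X W)) (length-filterᵇ≤1 _ transversal almostDisjointₒᵤₜ both)
    where
    both : ∀ V₁ V₂ → Transversal V₁ → Transversal V₂ → AlmostDisjoint V₁ V₂ →
      incidentᵇ (trace V₁) W ≡ true → incidentᵇ (trace V₂) W ≡ true → ⊥
    both V₁ V₂ t₁ t₂ r h₁ h₂ = <⇒≱ (<ᵇ⇒< 32 64 _) (begin
      64                                 ≡⟨ sym (cong₂ _*_ (transversal-card-trace t₁) (transversal-card-trace t₂)) ⟩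
      card 7 (trace V₁) * card 7 (trace V₂) ≤⟨ card*card≤card*2 7 (transversal-trace-isSubspace t₁) (transversal-trace-isSubspace t₂)
                                                (hasDim⇒isSubspace dW) (traces-almostDisjoint {V₁} {V₂} r)
                                                (incident⇒⊑ (transversal-trace-hasDim t₁) dW (<ᵇ⇒< 3 4 _) h₁)
                                                (incident⇒⊑ (transversal-trace-hasDim t₂) dW (<ᵇ⇒< 3 4 _) h₂) ⟩
      card 7 W * 2                       ≡⟨ cong₂ _*_ (hasDim⇒card dW) refl ⟩
      32                                 ∎)
      where open ≤-Reasoning

  -- The offsets of the codewords counted lie in pairwise different cosets of W, of which there are four.
  countInc-5space≤4 : ∀ W → HasDim W 5 → countInc W X ≤ 4
  countInc-5space≤4 W dW = subst (_≤ 4) (sym (countInc-X W))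
    (*32≤128⇒≤4 (length L) (≤-trans (card-⋃-disjoint coset disjoint cosetSize) (card≤2^n 7 (⋃ coset L))))
    where
    L = filterᵇ (λ V → incidentᵇ (trace V) W) Cₒᵤₜ
    coset : Sub 8 → Sub 7
    coset V u = W (u ⊕ offset V)
    inside : ∀ {V} → Transversal V → incidentᵇ (trace V) W ≡ true → trace V ⊑ W
    inside t h = incident⇒⊑ (transversal-trace-hasDim t) dW (<ᵇ⇒< 3 5 _) h
    disjoint : AllPairs (λ V₁ V₂ → ∀ u → coset V₁ u ≡ true → coset V₂ u ≡ true → ⊥) L
    disjoint = AllPairs-mapWithAll (All-filterᵇ⁺ _ transversal) (AllPairs-filterᵇ⁺ _ almostDisjointₒᵤₜ)
      λ (t₁ , h₁) (t₂ , h₂) r → offsets-in-distinct-cosets dW t₁ t₂ r (inside t₁ h₁) (inside t₂ h₂)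
    cosetSize : All (λ V → 32 ≤ card 7 (coset V)) L
    cosetSize = All.map (λ {V} _ → ≤-reflexive (sym (trans (card-translate 7 W (offset V)) (hasDim⇒card dW))))
                        (All-filterᵇ⁺ _ transversal)

  constraint-iv : ∀ W → HasDim W 5 → countInc W X ≤ 7 × ≤ω F W (countInc W X)
  constraint-iv W dW = ≤-trans (countInc-5space≤4 W dW) (≤ᵇ⇒≤ 4 7 _) ,
    (filterᵇ (λ U → incidentᵇ U W) X , AllPairs-filterᵇ⁺ _ X-distinct , All-filterᵇ⁺ _ X-inVar ,
     AllPairs-filterᵇ⁺ _ X-almostDisjoint , ≤-refl)

  countInc-extend≤ : ∀ W → HasDim W 6 → ∀ a → countInc (extend W a) Cₒᵤₜ ≤ length F ∸ countInc W F
  countInc-extend≤ W dW a = m+n≤o⇒m≤o∸n (countInc Y Cₒᵤₜ) (begin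
    countInc Y Cₒᵤₜ + countInc W F  ≤⟨ +-monoʳ-≤ (countInc Y Cₒᵤₜ) fromF ⟩
    countInc Y Cₒᵤₜ + countInc Y Cᵢₙ ≡⟨ +-comm (countInc Y Cₒᵤₜ) _ ⟩
    countInc Y Cᵢₙ + countInc Y Cₒᵤₜ ≡⟨ sym (countInc-C Y) ⟩
    countInc Y C                     ≤⟨ hyperplanes Y (extend-hasDim a dW) ⟩
    length F                         ∎)
    where
    open ≤-Reasoning
    Y = extend W a
    fromF : countInc W F ≤ countInc Y Cᵢₙ
    fromF = countInc-F≤countInc-Cᵢₙ (λ S → incidentᵇ S W) Y
      (λ S dS h → inj₁ (ι⊑extend a (incident⇒⊑ dS dW (<ᵇ⇒< 4 6 _) h)))

  -- With z ∉ W, every codeword counted lies in one of the hyperplanes extend W 0 and extend W z.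
  countInc-6space≤ : ∀ W → HasDim W 6 → ∀ {z} → W z ≡ false → countInc W X ≤ 2 * (length F ∸ countInc W F)
  countInc-6space≤ W dW {z} z∉W = subst (_≤ 2 * m) (sym (countInc-X W)) (begin
    length (filterᵇ (λ V → incidentᵇ (trace V) W) Cₒᵤₜ)
      ≤⟨ length-filterᵇ-∨ (λ V → incidentᵇ (trace V) W) (λ V → incidentᵇ V (extend W zeroV)) (λ V → incidentᵇ V (extend W z))
                          transversal lies-in ⟩
    countInc (extend W zeroV) Cₒᵤₜ + countInc (extend W z) Cₒᵤₜ
      ≤⟨ +-mono-≤ (countInc-extend≤ W dW zeroV) (countInc-extend≤ W dW z) ⟩
    m + m
      ≡⟨ cong (m +_) (sym (+-identityʳ m)) ⟩
    2 * m ∎)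
    where
    open ≤-Reasoning
    m = length F ∸ countInc W F
    sW = hasDim⇒isSubspace dW
    lies-in : ∀ V → Transversal V → incidentᵇ (trace V) W ≡ true →
      incidentᵇ V (extend W zeroV) ≡ true ⊎ incidentᵇ V (extend W z) ≡ true
    lies-in V t h = [ (λ w → inj₁ (⊑⇒incidentᵇ V (extend W zeroV)
                                    (transversal-⊑extend t sW tr (subst (λ u → W u ≡ true) (sym (⊕-identityʳ (offset V))) w))))
                    , (λ w → inj₂ (⊑⇒incidentᵇ V (extend W z) (transversal-⊑extend t sW tr w))) ]′
                    (hyperplane-cover dW z∉W (offset V))
      where tr = incident⇒⊑ (transversal-trace-hasDim t) dW (<ᵇ⇒< 3 6 _) h

  constraint-v : ∀ W → HasDim W 6 → countInc W X ≤ 2 * (length F ∸ countInc W F)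
  constraint-v W dW = countInc-6space≤ W dW (proj₂ (∃-outside dW (<ᵇ⇒< 6 7 _)))

mainTheorem9 : (F : List (Sub 7)) → All (λ S → HasDim S 4) F → Distinct F →
    (length F ≡ 16 ⊎ length F ≡ 17) →
    (C : List (Sub 8)) → All (λ U → HasDim U 4) C → Distinct C →
    AllPairs (λ U W → ∀ d → SubspaceDist U W d → 6 ≤ d) C →
    255 ≤ length C →
    All (λ S → ι S ∈ˢ C) F →
    (∀ P → HasDim P 1 → countInc P C ≤ length F) →
    (∀ H → HasDim H 7 → countInc H C ≤ length F) →
    ≤zBLP F (length C)
mainTheorem9 F hF dF _ C hC _ far big inC points hyperplanes =
  X , (X-distinct , X-inVar , constraint-i , (λ W dW _ → constraint-ii W dW) , (λ W dW _ → constraint-iii W dW) ,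
       (λ W dW _ → constraint-iv W dW) , constraint-v , ≤-trans big length-C≤) ,
  length-C≤
  where open Code F hF dF C hC far inC points hyperplanes
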